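{- Fix an integer $\ell\geq 2$, let $A=\ell\times\omega$, and fix a recursive bijection $\psi:(\ell-1)\times\omega\times\omega\to\omega$. For $\alpha\in\{0,1\}^\omega$ define the binary relation $S_\alpha$ on $A$ by: $(i,n)\,S_\alpha\,(i+1,m)$ iff $\alpha_{\psi(i,n,m)}=1$ (for $i<\ell-1$), and no other pairs are related. If $\alpha$ is a KC-string, then the ranked diagram $(A,S_\alpha)$, with levels $L_i=\{i\}\times\omega$, is $\ell$-generic, i.e. it is a model of $T_\ell$.
   Context: The signature has unary relations $L_0,\ldots,L_{\ell-1}$ and a binary relation $S$. The theory $T_\ell$ consists of: (i) every $x$ satisfies some $L_i$; (ii) no $x$ satisfies two distinct $L_i,L_j$; (iii) $S(x,y)$ implies that for each $i\leq\ell-2$, $L_i(x)\to L_{i+1}(y)$; (iv) extension axioms: for each $i<\ell$, whenever $X,Y$ are disjoint finite subsets of $L_{i+1}$, $Z$ is a finite subset of $L_i$, and $X',Y'$ are disjoint finite subsets of $L_{i-1}$, there is $z\in L_i$ with $z\notin Z$ such that $S(z,x)$ for all $x\in X$, $S(x',z)$ for all $x'\in X'$, $\neg S(z,y)$ for all $y\in Y$, and $\neg S(y',z)$ for all $y'\in Y'$ (with $L_{ -1}=L_\ell=\emptyset$). KC-strings: fix a universal prefix algorithm $U$ (a universal partial recursive function $\{0,1\}^*\to\{0,1\}^*$ with prefix-free domain) and let $H(s)$ be the length of a shortest $p$ with $U(p)=s$. An infinite binary string $\alpha$ is a KC-string if $\exists m\,\forall n\; H(\alpha_0\cdots\alpha_{n-1})\geq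 n-m$. -}

module Defs where

open import Data.Nat using (ℕ; zero; suc; _+_; _*_; _∸_; _≤_; _<_)
open import Data.Fin using (Fin; toℕ)
open import Data.Vec using (Vec; []; _∷_; lookup)
open import Data.List using (List; []; _∷_; _++_; length)
open import Data.Bool using (Bool; true; false)
open import Data.Product using (Σ; _×_; _,_; ∃; proj₁; proj₂)
open import Data.Empty using (⊥)
open import Relation.Nullary using (¬_)
open import Relation.Binary.PropositionalEquality using (_≡_)
open import Data.List.Membership.Propositional using (_∈_; _∉_)
open import Data.List.Relation.Unary.All using (All)

data PR : ℕ → Set where
  zer  : ∀ {n} → PR n
  succ : PR 1
  proj : ∀ {n} → Fin n → PR n
  comp : ∀ {m n} → PR m → Vec (PR n) m → PR n
  prec : ∀ {n} → PR n → PR (suc (suc n)) → PR (suc n)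
  mu   : ∀ {n} → PR (suc n) → PR n

mutual
  data Eval : ∀ {n} → PR n → Vec ℕ n → ℕ → Set where
    ev-zer  : ∀ {n} {xs : Vec ℕ n} → Eval zer xs 0
    ev-succ : ∀ {x} → Eval succ (x ∷ []) (suc x)
    ev-proj : ∀ {n} {i : Fin n} {xs} → Eval (proj i) xs (lookup xs i)
    ev-comp : ∀ {m n} {f : PR m} {gs : Vec (PR n) m} {xs ys y} →
              EvalAll gs xs ys → Eval f ys y → Eval (comp f gs) xs y
    ev-prec-zero : ∀ {n} {f : PR n} {g} {xs y} →
              Eval f xs y → Eval (prec f g) (0 ∷ xs) y
    ev-prec-suc  : ∀ {n} {f : PR n} {g} {xs k r y} →
              Eval (prec f g) (k ∷ xs) r → Eval g (k ∷ r ∷ xs) y →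
              Eval (prec f g) (suc k ∷ xs) y
    ev-mu   : ∀ {n} {f : PR (suc n)} {xs y} →
              Eval f (y ∷ xs) 0 →
              (∀ z → z < y → Σ ℕ λ k → Eval f (z ∷ xs) (suc k)) →
              Eval (mu f) xs y

  data EvalAll : ∀ {m n} → Vec (PR n) m → Vec ℕ n → Vec ℕ m → Set where
    ev-[] : ∀ {n} {xs : Vec ℕ n} → EvalAll [] xs []
    ev-∷  : ∀ {m n} {g : PR n} {gs : Vec (PR n) m} {xs y ys} →
            Eval g xs y → EvalAll gs xs ys → EvalAll (g ∷ gs) xs (y ∷ ys)

-- Binary strings, coded bijectively by natural numbers.

BitString : Set
BitString = List Bool

code : BitString → ℕ
code []          = 0
code (false ∷ s) = suc (2 * code s)
code (true ∷ s)  = suc (suc (2 * code s))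

-- A machine (partial recursive function {0,1}* → {0,1}*) is given by
-- a unary partial recursive function on codes.
Machine : Set
Machine = PR 1

_⟨_⟩↓_ : Machine → BitString → BitString → Set
M ⟨ p ⟩↓ s = Eval M (code p ∷ []) (code s)

_IsPrefixOf_ : BitString → BitString → Set
p IsPrefixOf q = Σ BitString λ r → q ≡ p ++ r

PrefixFree : Machine → Set
PrefixFree M = ∀ p q s t → M ⟨ p ⟩↓ s → M ⟨ q ⟩↓ t → p IsPrefixOf q → p ≡ q

UniversalPrefix : Machine → Set
UniversalPrefix U =
  PrefixFree U ×
  (∀ (V : Machine) → PrefixFree V →
     Σ BitString λ q → ∀ p s → (U ⟨ q ++ p ⟩↓ s → V ⟨ p ⟩↓ s) × (V ⟨ p ⟩↓ s → U ⟨ q ++ p ⟩↓ s))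

prefix : (ℕ → Bool) → ℕ → BitString
prefix α zero    = []
prefix α (suc n) = α 0 ∷ prefix (λ k → α (suc k)) n

-- KC-string w.r.t. U:  ∃ m ∀ n  H_U(α₀…α_{n-1}) ≥ n - m,
-- i.e. every U-program p for α₀…α_{n-1} has n ≤ |p| + m.
KCString : Machine → (ℕ → Bool) → Set
KCString U α = Σ ℕ λ m → ∀ n p → U ⟨ p ⟩↓ prefix α n → n ≤ length p + m

AtLevel : ∀ {D : Set} (ℓ : ℕ) → (Fin ℓ → D → Set) → ℕ → D → Set
AtLevel ℓ L k x = Σ (Fin ℓ) λ j → toℕ j ≡ k × L j x

-- x lies in L_{i-1} (empty if i = 0)
BelowLevel : ∀ {D : Set} (ℓ : ℕ) → (Fin ℓ → D → Set) → Fin ℓ → D → Set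
BelowLevel ℓ L i x = Σ (Fin ℓ) λ j → suc (toℕ j) ≡ toℕ i × L j x

Disjoint : ∀ {D : Set} → List D → List D → Set
Disjoint X Y = ∀ x → x ∈ X → x ∈ Y → ⊥

ModelT : (ℓ : ℕ) (D : Set) → (Fin ℓ → D → Set) → (D → D → Set) → Set
ModelT ℓ D L S =
  (∀ (x : D) → Σ (Fin ℓ) λ i → L i x) ×
  (∀ (x : D) (i j : Fin ℓ) → L i x → L j x → i ≡ j) ×
  (∀ (x y : D) → S x y → ∀ (i j : Fin ℓ) → toℕ j ≡ suc (toℕ i) → L i x → L j y) ×
  (∀ (i : Fin ℓ) (X Y Z X' Y' : List D) →
     All (AtLevel ℓ L (suc (toℕ i))) X → All (AtLevel ℓ L (suc (toℕ i))) Y → Disjoint X Y →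
     All (L i) Z →
     All (BelowLevel ℓ L i) X' → All (BelowLevel ℓ L i) Y' → Disjoint X' Y' →
     Σ D λ z → L i z × z ∉ Z ×
       All (λ x → S z x) X × All (λ x' → S x' z) X' ×
       All (λ y → ¬ S z y) Y × All (λ y' → ¬ S y' z) Y')

Carrier : ℕ → Set
Carrier ℓ = Fin ℓ × ℕ

Level : (ℓ : ℕ) → Fin ℓ → Carrier ℓ → Set
Level ℓ i x = proj₁ x ≡ i

Sα : (ℓ : ℕ) → (Fin (ℓ ∸ 1) → ℕ → ℕ → ℕ) → (ℕ → Bool) →
     Carrier ℓ → Carrier ℓ → Set
Sα ℓ ψ α (i , n) (j , m) =
  Σ (Fin (ℓ ∸ 1)) λ i' → toℕ i ≡ toℕ i' × toℕ j ≡ suc (toℕ i') × α (ψ i' n m) ≡ true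

Bijective3 : ∀ {ℓ} → (Fin ℓ → ℕ → ℕ → ℕ) → Set
Bijective3 {ℓ} ψ =
  (∀ i n m i' n' m' → ψ i n m ≡ ψ i' n' m' → (i ≡ i') × (n ≡ n') × (m ≡ m')) ×
  (∀ k → Σ (Fin ℓ) λ i → Σ ℕ λ n → Σ ℕ λ m → ψ i n m ≡ k)

Recursive3 : ∀ {ℓ} → (Fin ℓ → ℕ → ℕ → ℕ) → Set
Recursive3 {ℓ} ψ = Σ (PR 3) λ g → ∀ i n m → Eval g (toℕ i ∷ n ∷ m ∷ []) (ψ i n m)

-- If α matched a computable pattern (bits τ e at positions pos n e, e < k, with disjoint
-- blocks n) in none of the first T = 2ᵏ (2N + 2) blocks, each of these blocks would differ
-- from τ in one of only 2ᵏ − 1 ways, and Bernoulli's inequality gives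
-- (2ᵏ − 1)ᵀ ≤ 2^(kT − (2N + 2)).  So a prefix-free machine that reads N in unary, the bits
-- of α outside the blocks literally and all differences as one base-(2ᵏ − 1) numeral
-- prints a prefix of α of length K from K − N − 1 bits.  Simulated by the universal
-- machine with prefix q, and with N = |q| + m for the KC constant m of α, this contradicts
-- H(α↾K) ≥ K − m.  The extension axiom for a fresh point z = (i, n₀ + n) is such a
-- pattern: the prescribed edges between z and the finitely many given points of the
-- levels i ± 1.

module Submission where

open import Defs
open import Data.Bool using (Bool; true; false; _xor_)
import Data.Bool as Bool
open import Data.Empty using (⊥; ⊥-elim)
open import Data.Fin using (Fin; toℕ; fromℕ<; #_) renaming (zero to fzero; suc to fsuc)
open import Data.Fin.Properties using (toℕ-injective; toℕ-fromℕ<; toℕ<n)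
open import Data.List using (List; []; _∷_; _++_; length; drop; replicate; map; deduplicate)
open import Data.List.Extrema.Nat using (max; xs≤max)
open import Data.List.Membership.Propositional using (_∈_; _∉_; find; lose)
open import Data.List.Membership.Propositional.Properties
  using (∈-map⁺; ∈-map⁻; ∈-++⁺ˡ; ∈-++⁺ʳ; ∈-++⁻; ∈-deduplicate⁺; ∈-deduplicate⁻)
open import Data.List.Properties using (drop-drop; length-drop; length-++; ++-identityʳ; ++-assoc; length-replicate)
open import Data.List.Relation.Unary.All as All using (All)
open import Data.List.Relation.Unary.AllPairs using (_∷_)
open import Data.List.Relation.Unary.Any using (here; there; any?)
open import Data.List.Relation.Unary.Unique.Propositional using (Unique)
open import Data.Nat
  using (ℕ; zero; suc; _+_; _*_; _∸_; _^_; _≤_; _<_; z≤n; s≤s; s≤s⁻¹; pred; NonZero; >-nonZero; >-nonZero⁻¹; _<?_)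
import Data.Nat as ℕ
open import Data.Nat.Properties
open import Algebra.Properties.CommutativeSemigroup +-commutativeSemigroup using () renaming (interchange to +-interchange)
open import Data.Nat.DivMod
open import Data.Nat.Divisibility using (divides-refl)
open import Data.Nat.GeneralisedArithmetic using (fold)
open import Data.Nat.Tactic.RingSolver using (solve-∀)
open import Data.Product using (Σ; ∃; ∃₂; _×_; _,_; proj₁; proj₂)
open import Data.Product.Properties using (≡-dec)
open import Data.List.Relation.Unary.Unique.DecPropositional.Properties (≡-dec Bool._≟_ ℕ._≟_) using (deduplicate-!)
open import Data.Sum using (_⊎_; inj₁; inj₂; fromInj₁)
open import Data.Vec using (Vec; []; _∷_; lookup; tabulate)
open import Data.Vec.Properties using (tabulate∘lookup)
open import Function using (_∘_)
open import Relation.Binary.Definitions using (tri<; tri≈; tri>)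
open import Relation.Binary.PropositionalEquality
open import Relation.Nullary using (¬_; Dec; yes; no; does)
open import Relation.Nullary.Decidable using (¬?; decidable-stable)

accumulate : (ℕ → ℕ → ℕ) → ℕ → ℕ → (ℕ → ℕ) → ℕ
accumulate _⊙_ e zero    f = e
accumulate _⊙_ e (suc c) f = accumulate _⊙_ e c f ⊙ f c

sumBelow : ℕ → (ℕ → ℕ) → ℕ
sumBelow = accumulate _+_ 0

prodBelow : ℕ → (ℕ → ℕ) → ℕ
prodBelow = accumulate _*_ 1

accumulate-cong : ∀ _⊙_ e c {f g : ℕ → ℕ} → (∀ {i} → i < c → f i ≡ g i) →
                  accumulate _⊙_ e c f ≡ accumulate _⊙_ e c g
accumulate-cong _⊙_ e zero    f≡g = refl
accumulate-cong _⊙_ e (suc c) f≡g =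
  cong₂ _⊙_ (accumulate-cong _⊙_ e c (λ i<c → f≡g (m<n⇒m<1+n i<c))) (f≡g ≤-refl)

sumBelow-cong : ∀ c {f g : ℕ → ℕ} → (∀ {i} → i < c → f i ≡ g i) → sumBelow c f ≡ sumBelow c g
sumBelow-cong = accumulate-cong _+_ 0

prodBelow-cong : ∀ c {f g : ℕ → ℕ} → (∀ {i} → i < c → f i ≡ g i) → prodBelow c f ≡ prodBelow c g
prodBelow-cong = accumulate-cong _*_ 1

sumBelow-const : ∀ c k → sumBelow c (λ _ → k) ≡ c * k
sumBelow-const zero    k = refl
sumBelow-const (suc c) k = trans (cong (_+ k) (sumBelow-const c k)) (+-comm (c * k) k)

sumBelow-zero : ∀ c {f : ℕ → ℕ} → (∀ {i} → i < c → f i ≡ 0) → sumBelow c f ≡ 0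
sumBelow-zero c f≡0 = trans (sumBelow-cong c f≡0) (trans (sumBelow-const c 0) (*-zeroʳ c))

sumBelow-single : ∀ c {f : ℕ → ℕ} {i₀} → i₀ < c → (∀ {i} → i < c → i ≢ i₀ → f i ≡ 0) →
                  sumBelow c f ≡ f i₀
sumBelow-single (suc c) {f} {i₀} i₀<1+c f≡0 with i₀ ≟ c
... | yes refl = cong (_+ f c) (sumBelow-zero c (λ i<c → f≡0 (m<n⇒m<1+n i<c) (<⇒≢ i<c)))
... | no  i₀≢c = trans (cong₂ _+_ (sumBelow-single c (≤∧≢⇒< (s≤s⁻¹ i₀<1+c) i₀≢c) (λ i<c → f≡0 (m<n⇒m<1+n i<c)))
                                  (f≡0 ≤-refl (≢-sym i₀≢c)))
                           (+-identityʳ (f i₀))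

sumBelow-indicator : ∀ c {f : ℕ → ℕ} {Q} → Q ≤ c → (∀ {i} → i < Q → f i ≡ 1) →
                     (∀ {i} → Q ≤ i → i < c → f i ≡ 0) → sumBelow c f ≡ Q
sumBelow-indicator zero    z≤n f≡1 f≡0 = refl
sumBelow-indicator (suc c) {f} {Q} Q≤1+c f≡1 f≡0 with Q ≟ suc c
... | yes refl = trans (cong₂ _+_ (sumBelow-indicator c ≤-refl (λ i<c → f≡1 (m<n⇒m<1+n i<c))
                                                    (λ c≤i i<c → ⊥-elim (<⇒≱ i<c c≤i)))
                                  (f≡1 ≤-refl))
                       (+-comm c 1)
... | no  Q≢1+c = trans (cong₂ _+_ (sumBelow-indicator c Q≤c f≡1 (λ Q≤i i<c → f≡0 Q≤i (m<n⇒m<1+n i<c)))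
                                   (f≡0 Q≤c ≤-refl))
                        (+-identityʳ Q)
  where Q≤c = s≤s⁻¹ (≤∧≢⇒< Q≤1+c Q≢1+c)

sumBelow-distrib-+ : ∀ c (f g : ℕ → ℕ) → sumBelow c (λ i → f i + g i) ≡ sumBelow c f + sumBelow c g
sumBelow-distrib-+ zero    f g = refl
sumBelow-distrib-+ (suc c) f g = trans (cong (_+ (f c + g c)) (sumBelow-distrib-+ c f g))
                                       (+-interchange (sumBelow c f) (sumBelow c g) (f c) (g c))

sumBelow-comm : ∀ a b (f : ℕ → ℕ → ℕ) →
                sumBelow a (λ x → sumBelow b (f x)) ≡ sumBelow b (λ y → sumBelow a (λ x → f x y))
sumBelow-comm zero    b f = sym (sumBelow-zero b (λ _ → refl))
sumBelow-comm (suc a) b f = trans (cong (_+ sumBelow b (f a)) (sumBelow-comm a b f))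
                                  (sym (sumBelow-distrib-+ b (λ y → sumBelow a (λ x → f x y)) (f a)))

term≤sumBelow : ∀ c (f : ℕ → ℕ) {i} → i < c → f i ≤ sumBelow c f
term≤sumBelow (suc c) f {i} i<1+c with i ≟ c
... | yes refl = m≤n+m (f i) (sumBelow c f)
... | no  i≢c  = ≤-trans (term≤sumBelow c f (≤∧≢⇒< (s≤s⁻¹ i<1+c) i≢c)) (m≤m+n _ _)

sumBelow≢0 : ∀ c (f : ℕ → ℕ) → sumBelow c f ≢ 0 → ∃ λ i → i < c × f i ≢ 0
sumBelow≢0 zero    f s≢0 = ⊥-elim (s≢0 refl)
sumBelow≢0 (suc c) f s≢0 with f c ≟ 0
... | no  fc≢0 = c , ≤-refl , fc≢0
... | yes fc≡0 with sumBelow≢0 c f (λ s≡0 → s≢0 (cong₂ _+_ s≡0 fc≡0))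
...   | i , i<c , fi≢0 = i , m<n⇒m<1+n i<c , fi≢0

prodBelow-const : ∀ c b → prodBelow c (λ _ → b) ≡ b ^ c
prodBelow-const zero    b = refl
prodBelow-const (suc c) b = trans (cong (_* b) (prodBelow-const c b)) (*-comm (b ^ c) b)

prodBelow-ones : ∀ c {f : ℕ → ℕ} → (∀ {i} → i < c → f i ≡ 1) → prodBelow c f ≡ 1
prodBelow-ones zero    f≡1 = refl
prodBelow-ones (suc c) f≡1 = cong₂ _*_ (prodBelow-ones c (λ i<c → f≡1 (m<n⇒m<1+n i<c))) (f≡1 ≤-refl)

prodBelow-zero : ∀ c {f : ℕ → ℕ} {i} → i < c → f i ≡ 0 → prodBelow c f ≡ 0
prodBelow-zero (suc c) {f} {i} i<1+c fi≡0 with i ≟ c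
... | yes refl = trans (cong (prodBelow c f *_) fi≡0) (*-zeroʳ (prodBelow c f))
... | no  i≢c  = cong (_* f c) (prodBelow-zero c (≤∧≢⇒< (s≤s⁻¹ i<1+c) i≢c) fi≡0)

-- Terms, their semantics and their compilation into PR programs

ifZero : ℕ → ℕ → ℕ → ℕ
ifZero zero    b c = b
ifZero (suc _) b c = c

ifZero-zero : ∀ {h} b c → h ≡ 0 → ifZero h b c ≡ b
ifZero-zero b c refl = refl

ifZero-suc : ∀ {h m} b c → h ≡ suc m → ifZero h b c ≡ c
ifZero-suc b c refl = refl

-- sum, prod and iter bind var fzero in their last argument
data Term (n : ℕ) : Set where
  var            : Fin n → Term n
  lit            : ℕ → Term n
  add mul monus  : Term n → Term n → Term n
  if0            : Term n → Term n → Term n → Term n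
  sum prod       : Term n → Term (suc n) → Term n
  iter           : Term n → Term n → Term (suc n) → Term n
  app            : ∀ {m} → Term m → Vec (Term n) m → Term n
  call           : ∀ {m} (g : PR m) (f : Vec ℕ m → ℕ) → (∀ xs → Eval g xs (f xs)) →
                   Vec (Term n) m → Term n

mutual
  ⟦_⟧ : ∀ {n} → Term n → Vec ℕ n → ℕ
  ⟦ var i ⟧        xs = lookup xs i
  ⟦ lit k ⟧        xs = k
  ⟦ add a b ⟧      xs = ⟦ a ⟧ xs + ⟦ b ⟧ xs
  ⟦ mul a b ⟧      xs = ⟦ a ⟧ xs * ⟦ b ⟧ xs
  ⟦ monus a b ⟧    xs = ⟦ a ⟧ xs ∸ ⟦ b ⟧ xs
  ⟦ if0 a b c ⟧    xs = ifZero (⟦ a ⟧ xs) (⟦ b ⟧ xs) (⟦ c ⟧ xs)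
  ⟦ sum b f ⟧      xs = sumBelow (⟦ b ⟧ xs) (λ i → ⟦ f ⟧ (i ∷ xs))
  ⟦ prod b f ⟧     xs = prodBelow (⟦ b ⟧ xs) (λ i → ⟦ f ⟧ (i ∷ xs))
  ⟦ iter b x f ⟧   xs = fold (⟦ x ⟧ xs) (λ a → ⟦ f ⟧ (a ∷ xs)) (⟦ b ⟧ xs)
  ⟦ app t us ⟧     xs = ⟦ t ⟧ (⟦ us ⟧* xs)
  ⟦ call g f _ us ⟧ xs = f (⟦ us ⟧* xs)

  ⟦_⟧* : ∀ {n m} → Vec (Term n) m → Vec ℕ n → Vec ℕ m
  ⟦ [] ⟧*     xs = []
  ⟦ u ∷ us ⟧* xs = ⟦ u ⟧ xs ∷ ⟦ us ⟧* xs

constᴾ : ∀ {n} → ℕ → PR n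
constᴾ zero    = zer
constᴾ (suc k) = comp succ (constᴾ k ∷ [])

constᴾ-correct : ∀ {n} k (xs : Vec ℕ n) → Eval (constᴾ k) xs k
constᴾ-correct zero    xs = ev-zer
constᴾ-correct (suc k) xs = ev-comp (ev-∷ (constᴾ-correct k xs) ev-[]) ev-succ

projections : ∀ {m n} → (Fin m → Fin n) → Vec (PR n) m
projections ρ = tabulate (λ i → proj (ρ i))

projections-correct : ∀ {m n} (ρ : Fin m → Fin n) (xs : Vec ℕ n) →
                      EvalAll (projections ρ) xs (tabulate (λ i → lookup xs (ρ i)))
projections-correct {zero}  ρ xs = ev-[]
projections-correct {suc m} ρ xs = ev-∷ ev-proj (projections-correct (λ i → ρ (fsuc i)) xs)

identityᴾ : ∀ {n} → Vec (PR n) n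
identityᴾ = projections (λ i → i)

identityᴾ-correct : ∀ {n} (xs : Vec ℕ n) → EvalAll (identityᴾ {n}) xs xs
identityᴾ-correct xs = subst (EvalAll identityᴾ xs) (tabulate∘lookup xs) (projections-correct (λ i → i) xs)

drop2ᴾ : ∀ {n} → Vec (PR (suc (suc n))) n
drop2ᴾ = projections (λ i → fsuc (fsuc i))

drop2ᴾ-correct : ∀ {n} k r (xs : Vec ℕ n) → EvalAll drop2ᴾ (k ∷ r ∷ xs) xs
drop2ᴾ-correct k r xs =
  subst (EvalAll drop2ᴾ (k ∷ r ∷ xs)) (tabulate∘lookup xs) (projections-correct (λ i → fsuc (fsuc i)) (k ∷ r ∷ xs))

addᴾ : PR 2
addᴾ = prec (proj fzero) (comp succ (proj (fsuc fzero) ∷ []))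

addᴾ-correct : ∀ a b → Eval addᴾ (a ∷ b ∷ []) (a + b)
addᴾ-correct zero    b = ev-prec-zero ev-proj
addᴾ-correct (suc a) b = ev-prec-suc (addᴾ-correct a b) (ev-comp (ev-∷ ev-proj ev-[]) ev-succ)

mulᴾ : PR 2
mulᴾ = prec zer (comp addᴾ (proj (fsuc (fsuc fzero)) ∷ proj (fsuc fzero) ∷ []))

mulᴾ-correct : ∀ a b → Eval mulᴾ (a ∷ b ∷ []) (a * b)
mulᴾ-correct zero    b = ev-prec-zero ev-zer
mulᴾ-correct (suc a) b =
  ev-prec-suc (mulᴾ-correct a b) (ev-comp (ev-∷ ev-proj (ev-∷ ev-proj ev-[])) (addᴾ-correct b (a * b)))

predᴾ : PR 1
predᴾ = prec zer (proj fzero)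

predᴾ-correct : ∀ r → Eval predᴾ (r ∷ []) (pred r)
predᴾ-correct zero    = ev-prec-zero ev-zer
predᴾ-correct (suc r) = ev-prec-suc (predᴾ-correct r) ev-proj

-- recursion is on the first argument, so the subtrahend comes first
monusᴾ : PR 2
monusᴾ = prec (proj fzero) (comp predᴾ (proj (fsuc fzero) ∷ []))

monusᴾ-correct : ∀ b a → Eval monusᴾ (b ∷ a ∷ []) (a ∸ b)
monusᴾ-correct zero    a = ev-prec-zero ev-proj
monusᴾ-correct (suc b) a = subst (Eval monusᴾ (suc b ∷ a ∷ [])) (pred[m∸n]≡m∸[1+n] a b)
  (ev-prec-suc (monusᴾ-correct b a) (ev-comp (ev-∷ ev-proj ev-[]) (predᴾ-correct (a ∸ b))))

withArgᴾ : ∀ {n} → PR n → PR (suc n) → PR n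
withArgᴾ b P = comp P (b ∷ identityᴾ)

withArgᴾ-correct : ∀ {n} {b : PR n} {P xs k y} → Eval b xs k → Eval P (k ∷ xs) y → Eval (withArgᴾ b P) xs y
withArgᴾ-correct eb eP = ev-comp (ev-∷ eb (identityᴾ-correct _)) eP

accumulateᴾ : ∀ {n} → PR 2 → PR n → PR (suc n) → PR (suc n)
accumulateᴾ h e f = prec e (comp h (proj (fsuc fzero) ∷ comp f (proj fzero ∷ drop2ᴾ) ∷ []))

accumulateᴾ-correct : ∀ {n} {h : PR 2} {e : PR n} {f : PR (suc n)} {_⊙_ : ℕ → ℕ → ℕ} {e₀ F xs} →
  (∀ a b → Eval h (a ∷ b ∷ []) (a ⊙ b)) → Eval e xs e₀ → (∀ i → Eval f (i ∷ xs) (F i)) →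
  ∀ c → Eval (accumulateᴾ h e f) (c ∷ xs) (accumulate _⊙_ e₀ c F)
accumulateᴾ-correct he ee ef zero    = ev-prec-zero ee
accumulateᴾ-correct he ee ef (suc c) = ev-prec-suc (accumulateᴾ-correct he ee ef c)
  (ev-comp (ev-∷ ev-proj (ev-∷ (ev-comp (ev-∷ ev-proj (drop2ᴾ-correct _ _ _)) (ef c)) ev-[])) (he _ _))

mutual
  compile : ∀ {n} → Term n → PR n
  compile (var i)         = proj i
  compile (lit k)         = constᴾ k
  compile (add a b)       = comp addᴾ (compile a ∷ compile b ∷ [])
  compile (mul a b)       = comp mulᴾ (compile a ∷ compile b ∷ [])
  compile (monus a b)     = comp monusᴾ (compile b ∷ compile a ∷ [])
  compile (if0 a b c)     = withArgᴾ (compile a) (prec (compile b) (comp (compile c) drop2ᴾ))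
  compile (sum b f)       = withArgᴾ (compile b) (accumulateᴾ addᴾ zer (compile f))
  compile (prod b f)      = withArgᴾ (compile b) (accumulateᴾ mulᴾ (constᴾ 1) (compile f))
  compile (iter b x f)    = withArgᴾ (compile b) (prec (compile x) (comp (compile f) (proj (fsuc fzero) ∷ drop2ᴾ)))
  compile (app t us)      = comp (compile t) (compile* us)
  compile (call g _ _ us) = comp g (compile* us)

  compile* : ∀ {n m} → Vec (Term n) m → Vec (PR n) m
  compile* []       = []
  compile* (u ∷ us) = compile u ∷ compile* us

mutual
  compile-correct : ∀ {n} (t : Term n) (xs : Vec ℕ n) → Eval (compile t) xs (⟦ t ⟧ xs)
  compile-correct (var i)   xs = ev-proj
  compile-correct (lit k)   xs = constᴾ-correct k xs
  compile-correct (add a b) xs =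
    ev-comp (ev-∷ (compile-correct a xs) (ev-∷ (compile-correct b xs) ev-[])) (addᴾ-correct _ _)
  compile-correct (mul a b) xs =
    ev-comp (ev-∷ (compile-correct a xs) (ev-∷ (compile-correct b xs) ev-[])) (mulᴾ-correct _ _)
  compile-correct (monus a b) xs =
    ev-comp (ev-∷ (compile-correct b xs) (ev-∷ (compile-correct a xs) ev-[])) (monusᴾ-correct _ _)
  compile-correct (if0 a b c) xs = withArgᴾ-correct (compile-correct a xs) (cases (⟦ a ⟧ xs))
    where
    cases : ∀ k → Eval (prec (compile b) (comp (compile c) drop2ᴾ)) (k ∷ xs) (ifZero k (⟦ b ⟧ xs) (⟦ c ⟧ xs))
    cases zero    = ev-prec-zero (compile-correct b xs)
    cases (suc k) = ev-prec-suc (cases k) (ev-comp (drop2ᴾ-correct _ _ xs) (compile-correct c xs))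
  compile-correct (sum b f) xs = withArgᴾ-correct (compile-correct b xs)
    (accumulateᴾ-correct addᴾ-correct ev-zer (λ i → compile-correct f (i ∷ xs)) (⟦ b ⟧ xs))
  compile-correct (prod b f) xs = withArgᴾ-correct (compile-correct b xs)
    (accumulateᴾ-correct mulᴾ-correct (constᴾ-correct 1 xs) (λ i → compile-correct f (i ∷ xs)) (⟦ b ⟧ xs))
  compile-correct (iter b x f) xs = withArgᴾ-correct (compile-correct b xs) (iterate (⟦ b ⟧ xs))
    where
    iterate : ∀ k → Eval (prec (compile x) (comp (compile f) (proj (fsuc fzero) ∷ drop2ᴾ))) (k ∷ xs)
                         (fold (⟦ x ⟧ xs) (λ a → ⟦ f ⟧ (a ∷ xs)) k)
    iterate zero    = ev-prec-zero (compile-correct x xs)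
    iterate (suc k) = ev-prec-suc (iterate k) (ev-comp (ev-∷ ev-proj (drop2ᴾ-correct _ _ xs)) (compile-correct f _))
  compile-correct (app t us)        xs = ev-comp (compile*-correct us xs) (compile-correct t _)
  compile-correct (call g f gf us)  xs = ev-comp (compile*-correct us xs) (gf _)

  compile*-correct : ∀ {n m} (us : Vec (Term n) m) (xs : Vec ℕ n) → EvalAll (compile* us) xs (⟦ us ⟧* xs)
  compile*-correct []       xs = ev-[]
  compile*-correct (u ∷ us) xs = ev-∷ (compile-correct u xs) (compile*-correct us xs)

mutual
  Eval-functional : ∀ {n} {f : PR n} {xs y y′} → Eval f xs y → Eval f xs y′ → y ≡ y′
  Eval-functional ev-zer ev-zer = refl
  Eval-functional ev-succ ev-succ = refl
  Eval-functional ev-proj ev-proj = refl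
  Eval-functional (ev-comp as e) (ev-comp as′ e′) with EvalAll-functional as as′
  ... | refl = Eval-functional e e′
  Eval-functional (ev-prec-zero e) (ev-prec-zero e′) = Eval-functional e e′
  Eval-functional (ev-prec-suc r e) (ev-prec-suc r′ e′) with Eval-functional r r′
  ... | refl = Eval-functional e e′
  Eval-functional (ev-mu {y = y} e below) (ev-mu {y = y′} e′ below′) with <-cmp y y′
  ... | tri≈ _ y≡y′ _ = y≡y′
  ... | tri< y<y′ _ _ with below′ y y<y′
  ...   | _ , e″ with Eval-functional e e″
  ...     | ()
  Eval-functional (ev-mu {y = y} e below) (ev-mu {y = y′} e′ below′) | tri> _ _ y′<y with below y′ y′<y
  ...   | _ , e″ with Eval-functional e′ e″
  ...     | ()

  EvalAll-functional : ∀ {m n} {gs : Vec (PR n) m} {xs ys ys′} →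
                       EvalAll gs xs ys → EvalAll gs xs ys′ → ys ≡ ys′
  EvalAll-functional ev-[] ev-[] = refl
  EvalAll-functional (ev-∷ e es) (ev-∷ e′ es′) = cong₂ _∷_ (Eval-functional e e′) (EvalAll-functional es es′)

[r+q*n]/n≡q : ∀ {r} q n .{{_ : NonZero n}} → r < n → (r + q * n) / n ≡ q
[r+q*n]/n≡q {r} q n r<n = begin
  (r + q * n) / n  ≡⟨ +-distrib-/-∣ʳ r (divides-refl q) ⟩
  r / n + q * n / n ≡⟨ cong₂ _+_ (m<n⇒m/n≡0 r<n) (m*n/n≡m q n) ⟩
  q                 ∎
  where open ≡-Reasoning

[r+q*n]%n≡r : ∀ {r} q n .{{_ : NonZero n}} → r < n → (r + q * n) % n ≡ r
[r+q*n]%n≡r {r} q n r<n = trans ([m+kn]%n≡m%n r q n) (m<n⇒m%n≡m r<n)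

isZero isPositive : ℕ → ℕ
isZero x = ifZero x 1 0
isPositive x = ifZero x 0 1

isZeroᵗ isPositiveᵗ : ∀ {n} → Term n → Term n
isZeroᵗ a = if0 a (lit 1) (lit 0)
isPositiveᵗ a = if0 a (lit 0) (lit 1)

-- ⌊a / b⌋ is the number of i < a with b (1 + i) ≤ a
_divᵗ_ : ∀ {n} → Term n → Term n → Term n
a divᵗ b = app (sum (var (# 0)) (isZeroᵗ (monus (mul (var (# 2)) (add (lit 1) (var (# 0)))) (var (# 1))))) (a ∷ b ∷ [])

_modᵗ_ : ∀ {n} → Term n → Term n → Term n
a modᵗ b = monus a (mul b (a divᵗ b))

divᵗ-correct : ∀ {n} (a b : Term n) xs .{{_ : NonZero (⟦ b ⟧ xs)}} → ⟦ a divᵗ b ⟧ xs ≡ ⟦ a ⟧ xs / ⟦ b ⟧ xs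
divᵗ-correct a b xs = sumBelow-indicator A (m/n≤m A B) multiple not-multiple
  where
  A = ⟦ a ⟧ xs
  B = ⟦ b ⟧ xs
  multiple : ∀ {i} → i < A / B → isZero (B * suc i ∸ A) ≡ 1
  multiple {i} i<A/B = cong isZero (m≤n⇒m∸n≡0 (begin
    B * suc i   ≡⟨ *-comm B (suc i) ⟩
    suc i * B   ≤⟨ *-monoˡ-≤ B i<A/B ⟩
    A / B * B   ≤⟨ m/n*n≤m A B ⟩
    A           ∎))
    where open ≤-Reasoning
  not-multiple : ∀ {i} → A / B ≤ i → i < A → isZero (B * suc i ∸ A) ≡ 0
  not-multiple {i} A/B≤i _ with B * suc i ∸ A in eq
  ... | suc _ = refl
  ... | zero  = ⊥-elim (<⇒≱ (s≤s A/B≤i) (begin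
    suc i           ≡⟨ sym (m*n/n≡m (suc i) B) ⟩
    suc i * B / B   ≤⟨ /-monoˡ-≤ B (≤-trans (≤-reflexive (*-comm (suc i) B)) (m∸n≡0⇒m≤n eq)) ⟩
    A / B           ∎))
    where open ≤-Reasoning

modᵗ-correct : ∀ {n} (a b : Term n) xs .{{_ : NonZero (⟦ b ⟧ xs)}} → ⟦ a modᵗ b ⟧ xs ≡ ⟦ a ⟧ xs % ⟦ b ⟧ xs
modᵗ-correct a b xs = begin
  A ∸ B * ⟦ a divᵗ b ⟧ xs ≡⟨ cong (λ q → A ∸ B * q) (divᵗ-correct a b xs) ⟩
  A ∸ B * (A / B)        ≡⟨ cong (A ∸_) (*-comm B (A / B)) ⟩
  A ∸ A / B * B          ≡⟨ m%n≡m∸m/n*n A B ⟨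
  A % B                  ∎
  where
  open ≡-Reasoning
  A = ⟦ a ⟧ xs
  B = ⟦ b ⟧ xs

powᵗ : ∀ {n} → Term n → Term n → Term n
powᵗ a b = app (prod (var (# 1)) (var (# 1))) (a ∷ b ∷ [])

powᵗ-correct : ∀ {n} (a b : Term n) xs → ⟦ powᵗ a b ⟧ xs ≡ ⟦ a ⟧ xs ^ ⟦ b ⟧ xs
powᵗ-correct a b xs = prodBelow-const (⟦ b ⟧ xs) (⟦ a ⟧ xs)

dist : ℕ → ℕ → ℕ
dist x y = (x ∸ y) + (y ∸ x)

distᵗ : ∀ {n} → Term n → Term n → Term n
distᵗ a b = add (monus a b) (monus b a)

dist-refl : ∀ x → dist x x ≡ 0
dist-refl x = cong₂ _+_ (n∸n≡0 x) (n∸n≡0 x)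

dist≡0⇒≡ : ∀ {x y} → dist x y ≡ 0 → x ≡ y
dist≡0⇒≡ {x} {y} eq = ≤-antisym (m∸n≡0⇒m≤n (m+n≡0⇒m≡0 _ eq)) (m∸n≡0⇒m≤n (m+n≡0⇒n≡0 (x ∸ y) eq))

δ : ℕ → ℕ → ℕ
δ x y = isZero (dist x y)

δᵗ : ∀ {n} → Term n → Term n → Term n
δᵗ a b = isZeroᵗ (distᵗ a b)

δ-refl : ∀ x → δ x x ≡ 1
δ-refl x = cong isZero (dist-refl x)

δ-≢ : ∀ {x y} → x ≢ y → δ x y ≡ 0
δ-≢ {x} {y} x≢y with dist x y in eq
... | suc _ = refl
... | zero  = ⊥-elim (x≢y (dist≡0⇒≡ eq))

δ≢0⇒≡ : ∀ {x y} → δ x y ≢ 0 → x ≡ y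
δ≢0⇒≡ {x} {y} δ≢0 with x ≟ y
... | yes x≡y = x≡y
... | no  x≢y = ⊥-elim (δ≢0 (δ-≢ x≢y))

digitᵗ : ∀ {n} → Term n → Term n → Term n → Term n
digitᵗ x β i = (x divᵗ powᵗ β i) modᵗ β

digitᵗ-correct : ∀ {n} (x β i : Term n) xs {X B I} → ⟦ x ⟧ xs ≡ X → ⟦ β ⟧ xs ≡ B → ⟦ i ⟧ xs ≡ I →
                 .{{_ : NonZero B}} → ⟦ digitᵗ x β i ⟧ xs ≡ (_/_ X (B ^ I) {{m^n≢0 B I}}) % B
digitᵗ-correct x β i xs refl refl refl =
  trans (modᵗ-correct (x divᵗ powᵗ β i) β xs)
        (cong (_% ⟦ β ⟧ xs) (trans (divᵗ-correct x (powᵗ β i) xs {{B^I≢0}})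
                                   (/-congʳ {{B^I≢0}} {{m^n≢0 (⟦ β ⟧ xs) (⟦ i ⟧ xs)}} (powᵗ-correct β i xs))))
  where
  B^I≢0 : NonZero (⟦ powᵗ β i ⟧ xs)
  B^I≢0 = subst NonZero (sym (powᵗ-correct β i xs)) (m^n≢0 (⟦ β ⟧ xs) (⟦ i ⟧ xs))

bit : Bool → ℕ
bit false = 0
bit true  = 1

bit<2 : ∀ b → bit b < 2
bit<2 false = s≤s z≤n
bit<2 true  = s≤s (s≤s z≤n)

bit-surjective : ∀ {n} → n < 2 → ∃ λ b → bit b ≡ n
bit-surjective {zero}         _ = false , refl
bit-surjective {suc zero}    _ = true , refl
bit-surjective {suc (suc _)} (s≤s (s≤s ()))

xor-≢ : ∀ {a b} → b ≢ a → a xor b ≡ true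
xor-≢ {false} {false} b≢a = ⊥-elim (b≢a refl)
xor-≢ {false} {true}  _   = refl
xor-≢ {true}  {false} _   = refl
xor-≢ {true}  {true}  b≢a = ⊥-elim (b≢a refl)

xor-cancelˡ : ∀ a b → a xor (a xor b) ≡ b
xor-cancelˡ false b     = refl
xor-cancelˡ true  false = refl
xor-cancelˡ true  true  = refl

xorᵗ : ∀ {n} → Term n → Term n → Term n
xorᵗ a c = if0 a c (isZeroᵗ c)

xorᵗ-correct : ∀ {n} (a c : Term n) xs {b b′} → ⟦ a ⟧ xs ≡ bit b → ⟦ c ⟧ xs ≡ bit b′ →
               ⟦ xorᵗ a c ⟧ xs ≡ bit (b xor b′)
xorᵗ-correct a c xs {false} {b′}    a≡ c≡ rewrite a≡ = c≡
xorᵗ-correct a c xs {true}  {false} a≡ c≡ rewrite a≡ | c≡ = refl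
xorᵗ-correct a c xs {true}  {true}  a≡ c≡ rewrite a≡ | c≡ = refl

code-∷ : ∀ b s → code (b ∷ s) ≡ suc (bit b + code s * 2)
code-∷ false s = cong suc (*-comm 2 (code s))
code-∷ true  s = cong (λ c → suc (suc c)) (*-comm 2 (code s))

code-∷+1 : ∀ b s → code (b ∷ s) + 1 ≡ bit b + 2 * (code s + 1)
code-∷+1 b s = trans (cong (_+ 1) (code-∷ b s)) (regroup (bit b) (code s))
  where
  regroup : ∀ a c → suc (a + c * 2) + 1 ≡ a + 2 * (c + 1)
  regroup = solve-∀

tailᵗ headᵗ : ∀ {n} → Term n → Term n
tailᵗ c = monus c (lit 1) divᵗ lit 2
headᵗ c = monus c (lit 1) modᵗ lit 2

tailᵗ-correct : ∀ {n} (c : Term n) xs {p} → ⟦ c ⟧ xs ≡ code p → ⟦ tailᵗ c ⟧ xs ≡ code (drop 1 p)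
tailᵗ-correct c xs {p} c≡ = begin
  ⟦ tailᵗ c ⟧ xs    ≡⟨ divᵗ-correct (monus c (lit 1)) (lit 2) xs ⟩
  (⟦ c ⟧ xs ∸ 1) / 2 ≡⟨ cong (λ x → (x ∸ 1) / 2) c≡ ⟩
  (code p ∸ 1) / 2   ≡⟨ halve p ⟩
  code (drop 1 p)    ∎
  where
  open ≡-Reasoning
  halve : ∀ p → (code p ∸ 1) / 2 ≡ code (drop 1 p)
  halve []      = refl
  halve (b ∷ s) = trans (cong (λ c → (c ∸ 1) / 2) (code-∷ b s)) ([r+q*n]/n≡q (code s) 2 (bit<2 b))

bitAt : List Bool → ℕ → Bool
bitAt []      _       = false
bitAt (b ∷ s) zero    = b
bitAt (b ∷ s) (suc i) = bitAt s i

bitAt-drop : ∀ p i → bitAt (drop i p) 0 ≡ bitAt p i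
bitAt-drop []      zero    = refl
bitAt-drop []      (suc i) = refl
bitAt-drop (b ∷ s) zero    = refl
bitAt-drop (b ∷ s) (suc i) = bitAt-drop s i

headᵗ-correct : ∀ {n} (c : Term n) xs {s} → ⟦ c ⟧ xs ≡ code s → ⟦ headᵗ c ⟧ xs ≡ bit (bitAt s 0)
headᵗ-correct c xs {s} c≡ = begin
  ⟦ headᵗ c ⟧ xs    ≡⟨ modᵗ-correct (monus c (lit 1)) (lit 2) xs ⟩
  (⟦ c ⟧ xs ∸ 1) % 2 ≡⟨ cong (λ x → (x ∸ 1) % 2) c≡ ⟩
  (code s ∸ 1) % 2   ≡⟨ parity s ⟩
  bit (bitAt s 0)    ∎
  where
  open ≡-Reasoning
  parity : ∀ s → (code s ∸ 1) % 2 ≡ bit (bitAt s 0)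
  parity []      = refl
  parity (b ∷ s) = trans (cong (λ c → (c ∸ 1) % 2) (code-∷ b s)) ([r+q*n]%n≡r (code s) 2 (bit<2 b))

dropᵗ : ∀ {n} → Term n → Term n → Term n
dropᵗ e c = iter e c (tailᵗ (var (# 0)))

dropᵗ-correct : ∀ {n} (e c : Term n) xs {p} → ⟦ c ⟧ xs ≡ code p → ⟦ dropᵗ e c ⟧ xs ≡ code (drop (⟦ e ⟧ xs) p)
dropᵗ-correct e c xs {p} c≡ = iterate (⟦ e ⟧ xs)
  where
  iterate : ∀ k → ⟦ dropᵗ (lit k) c ⟧ xs ≡ code (drop k p)
  iterate zero    = c≡
  iterate (suc k) = trans (tailᵗ-correct (var (# 0)) (_ ∷ xs) (iterate k))
                          (cong code (trans (drop-drop k 1 p) (cong (λ i → drop i p) (+-comm k 1))))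

bitAtᵗ : ∀ {n} → Term n → Term n → Term n
bitAtᵗ c i = headᵗ (dropᵗ i c)

bitAtᵗ-correct : ∀ {n} (c i : Term n) xs {p} → ⟦ c ⟧ xs ≡ code p → ⟦ bitAtᵗ c i ⟧ xs ≡ bit (bitAt p (⟦ i ⟧ xs))
bitAtᵗ-correct c i xs {p} c≡ = trans (headᵗ-correct (dropᵗ i c) xs (dropᵗ-correct i c xs c≡))
                                     (cong bit (bitAt-drop p (⟦ i ⟧ xs)))

lengthᵗ : ∀ {n} → Term n → Term n
lengthᵗ c = app (sum (var (# 0)) (isPositiveᵗ (dropᵗ (var (# 0)) (var (# 1))))) (c ∷ [])

length≤code : ∀ p → length p ≤ code p
length≤code []          = z≤n
length≤code (false ∷ s) = s≤s (≤-trans (length≤code s) (m≤m+n _ _))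
length≤code (true ∷ s)  = s≤s (≤-trans (length≤code s) (≤-trans (m≤m+n _ _) (n≤1+n _)))

isPositive-code : ∀ s → isPositive (code s) ≡ isPositive (length s)
isPositive-code []          = refl
isPositive-code (false ∷ s) = refl
isPositive-code (true ∷ s)  = refl

lengthᵗ-correct : ∀ {n} (c : Term n) xs {p} → ⟦ c ⟧ xs ≡ code p → ⟦ lengthᵗ c ⟧ xs ≡ length p
lengthᵗ-correct c xs {p} c≡ = begin
  ⟦ lengthᵗ c ⟧ xs
    ≡⟨ cong (λ x → ⟦ lengthᵗ (var (# 0)) ⟧ (x ∷ [])) c≡ ⟩
  sumBelow (code p) (λ i → isPositive (⟦ dropᵗ (var (# 0)) (var (# 1)) ⟧ (i ∷ code p ∷ [])))
    ≡⟨ sumBelow-cong (code p) (λ {i} _ → cong isPositive (dropᵗ-correct (var (# 0)) (var (# 1)) (i ∷ code p ∷ []) refl)) ⟩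
  sumBelow (code p) (λ i → isPositive (code (drop i p)))
    ≡⟨ sumBelow-indicator (code p) (length≤code p) inside outside ⟩
  length p
    ∎
  where
  open ≡-Reasoning
  isPositive-drop : ∀ i → isPositive (code (drop i p)) ≡ isPositive (length p ∸ i)
  isPositive-drop i = trans (isPositive-code (drop i p)) (cong isPositive (length-drop i p))
  inside : ∀ {i} → i < length p → isPositive (code (drop i p)) ≡ 1
  inside {i} i<len with length p ∸ i in eq
  ... | zero  = ⊥-elim (<⇒≱ i<len (m∸n≡0⇒m≤n eq))
  ... | suc _ = trans (isPositive-drop i) (cong isPositive eq)
  outside : ∀ {i} → length p ≤ i → i < code p → isPositive (code (drop i p)) ≡ 0
  outside {i} len≤i _ = trans (isPositive-drop i) (cong isPositive (m≤n⇒m∸n≡0 len≤i))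

leadingOnes : List Bool → ℕ
leadingOnes (true ∷ s) = suc (leadingOnes s)
leadingOnes _          = 0

leadingOnes≤length : ∀ p → leadingOnes p ≤ length p
leadingOnes≤length []          = z≤n
leadingOnes≤length (true ∷ s)  = s≤s (leadingOnes≤length s)
leadingOnes≤length (false ∷ s) = z≤n

bitAt-leadingOnes< : ∀ p {i} → i < leadingOnes p → bitAt p i ≡ true
bitAt-leadingOnes< (true ∷ s) {zero}  _         = refl
bitAt-leadingOnes< (true ∷ s) {suc i} (s≤s i<) = bitAt-leadingOnes< s i<

bitAt-leadingOnes : ∀ p → bitAt p (leadingOnes p) ≡ false
bitAt-leadingOnes []          = refl
bitAt-leadingOnes (true ∷ s)  = bitAt-leadingOnes s
bitAt-leadingOnes (false ∷ s) = refl

-- the i-th summand is 1 exactly when the first i + 1 bits are all ones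
leadingOnesᵗ : ∀ {n} → Term n → Term n
leadingOnesᵗ c = app (sum (var (# 0)) (prod (add (lit 1) (var (# 0))) (bitAtᵗ (var (# 2)) (var (# 0))))) (c ∷ [])

leadingOnesᵗ-correct : ∀ {n} (c : Term n) xs {p} → ⟦ c ⟧ xs ≡ code p → ⟦ leadingOnesᵗ c ⟧ xs ≡ leadingOnes p
leadingOnesᵗ-correct c xs {p} c≡ = begin
  ⟦ leadingOnesᵗ c ⟧ xs
    ≡⟨ cong (λ x → ⟦ leadingOnesᵗ (var (# 0)) ⟧ (x ∷ [])) c≡ ⟩
  sumBelow (code p) (λ i → prodBelow (suc i) (λ i′ → ⟦ bitAtᵗ (var (# 2)) (var (# 0)) ⟧ (i′ ∷ i ∷ code p ∷ [])))
    ≡⟨ sumBelow-cong (code p) (λ {i} _ → prodBelow-cong (suc i) (λ {i′} _ →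
         bitAtᵗ-correct (var (# 2)) (var (# 0)) (i′ ∷ i ∷ code p ∷ []) refl)) ⟩
  sumBelow (code p) (λ i → prodBelow (suc i) (λ i′ → bit (bitAt p i′)))
    ≡⟨ sumBelow-indicator (code p) (≤-trans (leadingOnes≤length p) (length≤code p)) inside outside ⟩
  leadingOnes p
    ∎
  where
  open ≡-Reasoning
  inside : ∀ {i} → i < leadingOnes p → prodBelow (suc i) (λ i′ → bit (bitAt p i′)) ≡ 1
  inside {i} i< = prodBelow-ones (suc i) (λ i′<1+i → cong bit (bitAt-leadingOnes< p (≤-<-trans (m<1+n⇒m≤n i′<1+i) i<)))
  outside : ∀ {i} → leadingOnes p ≤ i → i < code p → prodBelow (suc i) (λ i′ → bit (bitAt p i′)) ≡ 0
  outside {i} ≤i _ = prodBelow-zero (suc i) (s≤s ≤i) (cong bit (bitAt-leadingOnes p))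

leadingOnes-++ : ∀ p r → leadingOnes p < length p → leadingOnes (p ++ r) ≡ leadingOnes p
leadingOnes-++ (true ∷ s)  r (s≤s lead<) = cong suc (leadingOnes-++ s r lead<)
leadingOnes-++ (false ∷ s) r _           = refl

bitAt-++ : ∀ ys {b zs} → bitAt (ys ++ b ∷ zs) (length ys) ≡ b
bitAt-++ []       = refl
bitAt-++ (_ ∷ ys) = bitAt-++ ys

drop-++ : ∀ (ys zs : List Bool) → drop (length ys) (ys ++ zs) ≡ zs
drop-++ []       zs = refl
drop-++ (_ ∷ ys) zs = drop-++ ys zs

prefix-snoc : ∀ (α : ℕ → Bool) n → prefix α (suc n) ≡ prefix α n ++ α n ∷ []
prefix-snoc α zero    = refl
prefix-snoc α (suc n) = cong (α 0 ∷_) (prefix-snoc (λ k → α (suc k)) n)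

length-prefix : ∀ (α : ℕ → Bool) n → length (prefix α n) ≡ n
length-prefix α zero    = refl
length-prefix α (suc n) = cong suc (length-prefix (λ k → α (suc k)) n)

code-snoc : ∀ s b → code (s ++ b ∷ []) ≡ code s + 2 ^ length s * (bit b + 1)
code-snoc []      false = refl
code-snoc []      true  = refl
code-snoc (x ∷ s) b = begin
  code (x ∷ s ++ b ∷ [])                                   ≡⟨ code-∷ x (s ++ b ∷ []) ⟩
  suc (bit x + code (s ++ b ∷ []) * 2)                      ≡⟨ cong (λ c → suc (bit x + c * 2)) (code-snoc s b) ⟩
  suc (bit x + (code s + 2 ^ length s * (bit b + 1)) * 2)   ≡⟨ regroup (bit x) (code s) (2 ^ length s) (bit b) ⟩
  suc (bit x + code s * 2) + 2 * 2 ^ length s * (bit b + 1) ≡⟨ cong (_+ 2 * 2 ^ length s * (bit b + 1)) (code-∷ x s) ⟨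
  code (x ∷ s) + 2 ^ length (x ∷ s) * (bit b + 1)          ∎
  where
  open ≡-Reasoning
  regroup : ∀ a c P e → suc (a + (c + P * (e + 1)) * 2) ≡ suc (a + c * 2) + 2 * P * (e + 1)
  regroup = solve-∀

code-prefix : ∀ (α : ℕ → Bool) K → code (prefix α K) ≡ sumBelow K (λ t → 2 ^ t * (bit (α t) + 1))
code-prefix α zero    = refl
code-prefix α (suc K) = begin
  code (prefix α (suc K))                                  ≡⟨ cong code (prefix-snoc α K) ⟩
  code (prefix α K ++ α K ∷ [])                            ≡⟨ code-snoc (prefix α K) (α K) ⟩
  code (prefix α K) + 2 ^ length (prefix α K) * (bit (α K) + 1)
    ≡⟨ cong₂ (λ c l → c + 2 ^ l * (bit (α K) + 1)) (code-prefix α K) (length-prefix α K) ⟩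
  sumBelow (suc K) (λ t → 2 ^ t * (bit (α t) + 1))         ∎
  where open ≡-Reasoning

^-distribʳ-* : ∀ m n o → (m * n) ^ o ≡ m ^ o * n ^ o
^-distribʳ-* m n zero    = refl
^-distribʳ-* m n (suc o) = trans (cong (m * n *_) (^-distribʳ-* m n o)) (*-interchange m n (m ^ o) (n ^ o))
  where
  *-interchange : ∀ a b x y → a * b * (x * y) ≡ a * x * (b * y)
  *-interchange = solve-∀

digits< : ∀ β T (d : ℕ → ℕ) → (∀ {i} → i < T → d i < β) → sumBelow T (λ i → d i * β ^ i) < β ^ T
digits< β zero    d d<β = s≤s z≤n
digits< β (suc T) d d<β = begin-strict
  sumBelow T (λ i → d i * β ^ i) + d T * β ^ T <⟨ +-monoˡ-< (d T * β ^ T) (digits< β T d (λ i<T → d<β (m<n⇒m<1+n i<T))) ⟩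
  β ^ T + d T * β ^ T                           ≤⟨ *-monoˡ-≤ (β ^ T) (d<β ≤-refl) ⟩
  β * β ^ T                                     ∎
  where open ≤-Reasoning

digits-split : ∀ β T (d : ℕ → ℕ) → (∀ {i} → i < T → d i < β) → ∀ {n} → n < T →
               ∃₂ λ S Y → sumBelow T (λ i → d i * β ^ i) ≡ S + (d n + Y * β) * β ^ n × S < β ^ n
digits-split β (suc T) d d<β {n} n<1+T with m<1+n⇒m<n∨m≡n n<1+T
... | inj₂ refl = sumBelow n (λ i → d i * β ^ i) , 0 ,
                  cong (λ x → sumBelow n (λ i → d i * β ^ i) + x * β ^ n) (sym (+-identityʳ (d n))) ,
                  digits< β n d (λ i<n → d<β (m<n⇒m<1+n i<n))
... | inj₁ n<T with digits-split β T d (λ i<T → d<β (m<n⇒m<1+n i<T)) n<T | m≤n⇒∃[o]m+o≡n n<T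
...   | S , Y , digits≡ , S< | u , refl = S , Y + d (suc n + u) * β ^ u , split , S<
  where
  split : sumBelow (suc n + u) (λ i → d i * β ^ i) + d (suc n + u) * β ^ (suc n + u) ≡
          S + (d n + (Y + d (suc n + u) * β ^ u) * β) * β ^ n
  split rewrite digits≡ | ^-distribˡ-+-* β n u = regroup S (d n) Y β (β ^ n) (d (suc (n + u))) (β ^ u)
    where
    regroup : ∀ S a Y b B D P → S + (a + Y * b) * B + D * (b * (B * P)) ≡ S + (a + (Y + D * P) * b) * B
    regroup = solve-∀

digit : ∀ β .{{_ : NonZero β}} T (d : ℕ → ℕ) → (∀ {i} → i < T → d i < β) → ∀ {n} → n < T →
        (_/_ (sumBelow T (λ i → d i * β ^ i)) (β ^ n) {{m^n≢0 β n}}) % β ≡ d n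
digit β T d d<β {n} n<T with digits-split β T d d<β n<T
... | S , Y , digits≡ , S< = begin
  (_/_ (sumBelow T (λ i → d i * β ^ i)) (β ^ n) {{m^n≢0 β n}}) % β
    ≡⟨ cong (λ x → (_/_ x (β ^ n) {{m^n≢0 β n}}) % β) digits≡ ⟩
  (_/_ (S + (d n + Y * β) * β ^ n) (β ^ n) {{m^n≢0 β n}}) % β
    ≡⟨ cong (_% β) ([r+q*n]/n≡q (d n + Y * β) (β ^ n) {{m^n≢0 β n}} S<) ⟩
  (d n + Y * β) % β
    ≡⟨ [r+q*n]%n≡r Y β (d<β n<T) ⟩
  d n
    ∎
  where open ≡-Reasoning

bernoulli : ∀ D m → D ^ suc m + suc m * D ^ m ≤ suc D ^ suc m
bernoulli D zero    = ≤-reflexive (base D)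
  where
  base : ∀ D → D * 1 + 1 * 1 ≡ suc D * 1
  base = solve-∀
bernoulli D (suc m) = begin
  D ^ suc (suc m) + suc (suc m) * D ^ suc m                     ≤⟨ m≤m+n _ (suc m * D ^ m) ⟩
  D ^ suc (suc m) + suc (suc m) * D ^ suc m + suc m * D ^ m     ≡⟨ expand D m (D ^ m) ⟩
  suc D * (D ^ suc m + suc m * D ^ m)                           ≤⟨ *-monoʳ-≤ (suc D) (bernoulli D m) ⟩
  suc D ^ suc (suc m)                                           ∎
  where
  open ≤-Reasoning
  expand : ∀ D m P → D * (D * P) + (2 + m) * (D * P) + (1 + m) * P ≡ (1 + D) * (D * P + (1 + m) * P)
  expand = solve-∀

2*D^[1+D]≤[1+D]^[1+D] : ∀ D → D ^ suc D * 2 ≤ suc D ^ suc D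
2*D^[1+D]≤[1+D]^[1+D] D = begin
  D ^ suc D * 2                    ≡⟨ *-comm (D ^ suc D) 2 ⟩
  D ^ suc D + (D ^ suc D + 0)      ≡⟨ cong (D ^ suc D +_) (+-identityʳ (D ^ suc D)) ⟩
  D ^ suc D + D * D ^ D            ≤⟨ +-monoʳ-≤ (D ^ suc D) (*-monoˡ-≤ (D ^ D) (n≤1+n D)) ⟩
  D ^ suc D + suc D * D ^ D        ≤⟨ bernoulli D D ⟩
  suc D ^ suc D                    ∎
  where open ≤-Reasoning

-- T = 2ᵏ j blocks, each taking one of 2ᵏ − 1 values, fit into k T − j bits
blocks≤bits : ∀ k j → 1 ≤ k → (2 ^ k ∸ 1) ^ (2 ^ k * j) ≤ 2 ^ (k * (2 ^ k * j) ∸ j)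
blocks≤bits k j 1≤k = *-cancelʳ-≤ _ _ (2 ^ j) {{m^n≢0 2 j}} (begin
  D ^ (B * j) * 2 ^ j            ≡⟨ cong (_* 2 ^ j) (^-*-assoc D B j) ⟨
  (D ^ B) ^ j * 2 ^ j            ≡⟨ ^-distribʳ-* (D ^ B) 2 j ⟨
  (D ^ B * 2) ^ j                ≤⟨ ^-monoˡ-≤ j (subst (λ x → D ^ x * 2 ≤ x ^ x) 1+D≡B (2*D^[1+D]≤[1+D]^[1+D] D)) ⟩
  (B ^ B) ^ j                    ≡⟨ cong (_^ j) (^-*-assoc 2 k B) ⟩
  (2 ^ (k * B)) ^ j              ≡⟨ ^-*-assoc 2 (k * B) j ⟩
  2 ^ (k * B * j)                ≡⟨ cong (2 ^_) (trans (*-assoc k B j) (sym (m∸n+n≡m j≤kBj))) ⟩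
  2 ^ (k * (B * j) ∸ j + j)      ≡⟨ ^-distribˡ-+-* 2 (k * (B * j) ∸ j) j ⟩
  2 ^ (k * (B * j) ∸ j) * 2 ^ j  ∎)
  where
  open ≤-Reasoning
  B = 2 ^ k
  D = B ∸ 1
  1+D≡B : suc D ≡ B
  1+D≡B = trans (+-comm 1 D) (m∸n+n≡m (m^n>0 2 k))
  j≤kBj : j ≤ k * (B * j)
  j≤kBj = ≤-trans (m≤n*m j B {{m^n≢0 2 k}}) (m≤n*m (B * j) k {{>-nonZero 1≤k}})

numeral : ∀ w x → x < 2 ^ w → ∃ λ s → length s ≡ w × code s + 1 ≡ x + 2 ^ w
numeral zero    zero    _ = [] , refl , refl
numeral zero    (suc x) (s≤s ())
numeral (suc w) x x<2^[1+w]
  with numeral w (x / 2) (m<n*o⇒m/o<n (subst (x <_) (*-comm 2 (2 ^ w)) x<2^[1+w])) | bit-surjective (m%n<n x 2)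
... | s , |s|≡w , code≡ | b , b≡ = b ∷ s , cong suc |s|≡w , (begin
  code (b ∷ s) + 1                ≡⟨ code-∷+1 b s ⟩
  bit b + 2 * (code s + 1)        ≡⟨ cong₂ (λ y z → y + 2 * z) b≡ code≡ ⟩
  x % 2 + 2 * (x / 2 + 2 ^ w)     ≡⟨ regroup (x % 2) (x / 2) (2 ^ w) ⟩
  (x % 2 + x / 2 * 2) + 2 * 2 ^ w ≡⟨ cong (_+ 2 * 2 ^ w) (m≡m%n+[m/n]*n x 2) ⟨
  x + 2 ^ suc w                   ∎)
  where
  open ≡-Reasoning
  regroup : ∀ r q P → r + 2 * (q + P) ≡ (r + q * 2) + 2 * P
  regroup = solve-∀

-- The decompressor

-- An input 1ᴺ 0 r is accepted iff |r| = L(N).  The output, of length K(N), is read off r: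
-- at position pos n e of block n < T = 2ᵏ (2N + 2) it is τ e xor the e-th binary digit of
-- 1 + (the n-th base-(2ᵏ − 1) digit of the number R held in the last w(N) bits of r);
-- all other bits are copied in order from the front of r.
module Decompressor (k : ℕ) (τᵗ : Term 1) (posᵗ : Term 2) where

  posAtᵗ : ∀ {n} → Term n → Term n → Term n
  posAtᵗ n e = app posᵗ (n ∷ e ∷ [])

  savingᵗ blocksᵗ widthᵗ outLengthᵗ : ∀ {n} → Term n → Term n
  savingᵗ N    = add (lit 2) (add N N)
  blocksᵗ N    = mul (powᵗ (lit 2) (lit k)) (savingᵗ N)
  widthᵗ N     = monus (mul (lit k) (blocksᵗ N)) (savingᵗ N)
  outLengthᵗ N = app (sum (blocksᵗ (var (# 0))) (sum (lit k) (add (posAtᵗ (var (# 1)) (var (# 0))) (lit 1)))) (N ∷ [])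

  -- ∑_{n < T} ∑_{e < k} g(e, n) · δ(pos n e, t), with g in the context e, n, N, t
  overBlocksᵗ : ∀ {n} → Term 4 → Term n → Term n → Term n
  overBlocksᵗ g N t = app (sum (blocksᵗ (var (# 0))) (sum (lit k)
                        (mul g (δᵗ (posAtᵗ (var (# 1)) (var (# 0))) (var (# 3)))))) (N ∷ t ∷ [])

  hitsᵗ blockᵗ offsetᵗ freeᵗ : ∀ {n} → Term n → Term n → Term n
  hitsᵗ   = overBlocksᵗ (lit 1)
  blockᵗ  = overBlocksᵗ (var (# 1))
  offsetᵗ = overBlocksᵗ (var (# 0))
  freeᵗ N t = app (sum (var (# 1)) (isZeroᵗ (hitsᵗ (var (# 1)) (var (# 0))))) (N ∷ t ∷ [])

  restLengthᵗ : ∀ {n} → Term n → Term n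
  restLengthᵗ N = add (freeᵗ N (outLengthᵗ N)) (widthᵗ N)

  numberᵗ : ∀ {n} → Term n → Term n → Term n
  numberᵗ r N = monus (add (dropᵗ (freeᵗ N (outLengthᵗ N)) r) (lit 1)) (powᵗ (lit 2) (widthᵗ N))

  blockBitᵗ outBitᵗ : ∀ {n} → Term n → Term n → Term n → Term n
  blockBitᵗ r N t = xorᵗ (app τᵗ (offsetᵗ N t ∷ []))
                         (digitᵗ (add (digitᵗ (numberᵗ r N) (monus (powᵗ (lit 2) (lit k)) (lit 1)) (blockᵗ N t)) (lit 1))
                                 (lit 2) (offsetᵗ N t))
  outBitᵗ r N t = if0 (hitsᵗ N t) (bitAtᵗ r (freeᵗ N t)) (blockBitᵗ r N t)

  -- opaque, since comparing two unfoldings of the decoder is very slow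
  opaque
    decode₂ : Term 2
    decode₂ = sum (outLengthᵗ (var (# 1)))
                  (mul (powᵗ (lit 2) (var (# 0))) (add (outBitᵗ (var (# 1)) (var (# 2)) (var (# 0))) (lit 1)))

  opaque
    unfolding decode₂

    decode₂-sum : ∀ r N → ⟦ decode₂ ⟧ (r ∷ N ∷ []) ≡
      sumBelow (⟦ outLengthᵗ (var (# 0)) ⟧ (N ∷ []))
               (λ t → ⟦ powᵗ (lit 2) (var (# 0)) ⟧ (t ∷ r ∷ N ∷ []) *
                      (⟦ outBitᵗ (var (# 1)) (var (# 2)) (var (# 0)) ⟧ (t ∷ r ∷ N ∷ []) + 1))
    decode₂-sum r N = refl

  outputᵗ : Term 1
  outputᵗ = app decode₂ (dropᵗ (add (leadingOnesᵗ (var (# 0))) (lit 1)) (var (# 0)) ∷ leadingOnesᵗ (var (# 0)) ∷ [])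

  gateᵗ : Term 2
  gateᵗ = distᵗ (lengthᵗ (var (# 1))) (add (add N (lit 1)) (restLengthᵗ N))
    where N = leadingOnesᵗ (var (# 1))

  -- μz. gate(c) halts (with value 0) iff gate(c) = 0, i.e. iff the input has length
  -- N + 1 + L(N); this makes the domain prefix-free.
  V : Machine
  V = comp addᴾ (compile outputᵗ ∷ mu (compile gateᵗ) ∷ [])

  restLength : ℕ → ℕ
  restLength N = ⟦ restLengthᵗ (var (# 0)) ⟧ (N ∷ [])

  expectedLength : BitString → ℕ
  expectedLength p = leadingOnes p + 1 + restLength (leadingOnes p)

  WellFormed : BitString → Set
  WellFormed p = length p ≡ expectedLength p

  gate-value : ∀ p → ⟦ gateᵗ ⟧ (0 ∷ code p ∷ []) ≡ dist (length p) (expectedLength p)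
  gate-value p = cong₂ (λ l N → dist l (N + 1 + restLength N))
                       (lengthᵗ-correct (var (# 1)) (0 ∷ code p ∷ []) refl)
                       (leadingOnesᵗ-correct (var (# 1)) (0 ∷ code p ∷ []) refl)

  V-halts : ∀ {p s} → V ⟨ p ⟩↓ s → WellFormed p × ⟦ outputᵗ ⟧ (code p ∷ []) ≡ code s
  V-halts {p} (ev-comp (ev-∷ output↓ (ev-∷ (ev-mu {y = z} gate↓ below) ev-[])) add↓) =
    dist≡0⇒≡ (trans (sym (gate-value p)) gate≡0) ,
    sym (trans (Eval-functional add↓ (addᴾ-correct _ _))
               (trans (cong₂ _+_ (Eval-functional output↓ (compile-correct outputᵗ _)) (search≡0 z below))
                      (+-identityʳ _)))
    where
    gate≡0 : ⟦ gateᵗ ⟧ (0 ∷ code p ∷ []) ≡ 0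
    gate≡0 = Eval-functional (compile-correct gateᵗ (z ∷ code p ∷ [])) gate↓
    search≡0 : ∀ z → (∀ z′ → z′ < z → ∃ λ v → Eval (compile gateᵗ) (z′ ∷ code p ∷ []) (suc v)) → z ≡ 0
    search≡0 zero    _     = refl
    search≡0 (suc z) below = ⊥-elim (0≢1+n (trans (sym gate≡0)
      (Eval-functional (compile-correct gateᵗ (0 ∷ code p ∷ [])) (proj₂ (below 0 (s≤s z≤n))))))

  V-run : ∀ {p s} → WellFormed p → ⟦ outputᵗ ⟧ (code p ∷ []) ≡ code s → V ⟨ p ⟩↓ s
  V-run {p} {s} wf output≡ =
    ev-comp (ev-∷ (compile-correct outputᵗ _) (ev-∷ (ev-mu gate↓ (λ _ ())) ev-[]))
            (subst (Eval addᴾ _) (trans (+-identityʳ _) output≡) (addᴾ-correct _ _))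
    where
    gate↓ : Eval (compile gateᵗ) (0 ∷ code p ∷ []) 0
    gate↓ = subst (Eval (compile gateᵗ) (0 ∷ code p ∷ []))
                  (trans (gate-value p) (trans (cong (λ l → dist l (expectedLength p)) wf) (dist-refl (expectedLength p))))
                  (compile-correct gateᵗ _)

  V-prefixFree : PrefixFree V
  V-prefixFree p q _ _ p↓ q↓ (r , refl) = sym (trans (cong (p ++_) (r≡[] r |r|≡0)) (++-identityʳ p))
    where
    wf-p = proj₁ (V-halts p↓)
    wf-q = proj₁ (V-halts q↓)
    lead<length : leadingOnes p < length p
    lead<length = subst (leadingOnes p <_) (sym wf-p) (≤-trans (≤-reflexive (+-comm 1 _)) (m≤m+n _ _))
    |r|≡0 : length p + length r ≡ length p + 0
    |r|≡0 = begin
      length p + length r ≡⟨ length-++ p ⟨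
      length (p ++ r)     ≡⟨ wf-q ⟩
      leadingOnes (p ++ r) + 1 + restLength (leadingOnes (p ++ r))
                          ≡⟨ cong (λ N → N + 1 + restLength N) (leadingOnes-++ p r lead<length) ⟩
      leadingOnes p + 1 + restLength (leadingOnes p)
                          ≡⟨ wf-p ⟨
      length p            ≡⟨ +-identityʳ (length p) ⟨
      length p + 0        ∎
      where open ≡-Reasoning
    r≡[] : ∀ (r : BitString) → length p + length r ≡ length p + 0 → r ≡ []
    r≡[] [] _ = refl
    r≡[] (_ ∷ r) eq = ⊥-elim (1+n≢0 (+-cancelˡ-≡ (length p) (suc (length r)) 0 eq))

ComputesBits : ℕ → Term 1 → (ℕ → Bool) → Set
ComputesBits k τᵗ τ = ∀ {e} → e < k → ⟦ τᵗ ⟧ (e ∷ []) ≡ bit (τ e)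

DisjointBlocks : ℕ → Term 2 → Set
DisjointBlocks k posᵗ =
  ∀ {n e n′ e′} → e < k → e′ < k → ⟦ posᵗ ⟧ (n ∷ e ∷ []) ≡ ⟦ posᵗ ⟧ (n′ ∷ e′ ∷ []) → n ≡ n′ × e ≡ e′

module Layout (k : ℕ) (τᵗ : Term 1) (posᵗ : Term 2) (N : ℕ) where

  open Decompressor k τᵗ posᵗ

  pos : ℕ → ℕ → ℕ
  pos n e = ⟦ posᵗ ⟧ (n ∷ e ∷ [])

  T K : ℕ
  T = ⟦ blocksᵗ (var (# 0)) ⟧ (N ∷ [])
  K = ⟦ outLengthᵗ (var (# 0)) ⟧ (N ∷ [])

  overBlocks : Term 4 → ℕ → ℕ
  overBlocks g t = ⟦ overBlocksᵗ g (var (# 0)) (var (# 1)) ⟧ (N ∷ t ∷ [])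

  hits free : ℕ → ℕ
  hits = overBlocks (lit 1)
  free t = ⟦ freeᵗ (var (# 0)) (var (# 1)) ⟧ (N ∷ t ∷ [])

  Block : ℕ → Set
  Block t = ∃₂ λ n e → n < T × e < k × pos n e ≡ t

  pos<K : ∀ {n e} → n < T → e < k → pos n e < K
  pos<K {n} {e} n<T e<k = ≤-trans (≤-reflexive (+-comm 1 (pos n e)))
    (≤-trans (term≤sumBelow k (λ e → pos n e + 1) e<k) (term≤sumBelow T (λ n → sumBelow k (λ e → pos n e + 1)) n<T))

  hits≢0⇒Block : ∀ {t} → hits t ≢ 0 → Block t
  hits≢0⇒Block {t} hits≢0 with sumBelow≢0 T _ hits≢0
  ... | n , n<T , inner≢0 with sumBelow≢0 k _ inner≢0
  ...   | e , e<k , δ≢0 = n , e , n<T , e<k , δ≢0⇒≡ (λ δ≡0 → δ≢0 (cong (1 *_) δ≡0))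

  module Injective (pos-injective : DisjointBlocks k posᵗ) where

    overBlocks-at : ∀ g {t} → ((n , e , _) : Block t) → overBlocks g t ≡ ⟦ g ⟧ (e ∷ n ∷ N ∷ t ∷ [])
    overBlocks-at g {t} (n , e , n<T , e<k , pos≡t) = begin
      overBlocks g t                                        ≡⟨ sumBelow-single T n<T other-block ⟩
      sumBelow k (λ e′ → G n e′)                            ≡⟨ sumBelow-single k e<k other-offset ⟩
      G n e                                                 ≡⟨ cong (λ x → ⟦ g ⟧ (e ∷ n ∷ N ∷ t ∷ []) * δ x t) pos≡t ⟩
      ⟦ g ⟧ (e ∷ n ∷ N ∷ t ∷ []) * δ t t                    ≡⟨ cong (⟦ g ⟧ (e ∷ n ∷ N ∷ t ∷ []) *_) (δ-refl t) ⟩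
      ⟦ g ⟧ (e ∷ n ∷ N ∷ t ∷ []) * 1                        ≡⟨ *-identityʳ _ ⟩
      ⟦ g ⟧ (e ∷ n ∷ N ∷ t ∷ [])                            ∎
      where
      open ≡-Reasoning
      G : ℕ → ℕ → ℕ
      G n′ e′ = ⟦ g ⟧ (e′ ∷ n′ ∷ N ∷ t ∷ []) * δ (pos n′ e′) t
      G≡0 : ∀ {n′ e′} → e′ < k → pos n′ e′ ≢ t → G n′ e′ ≡ 0
      G≡0 {n′} {e′} _ pos≢t = trans (cong (⟦ g ⟧ (e′ ∷ n′ ∷ N ∷ t ∷ []) *_) (δ-≢ pos≢t))
                                    (*-zeroʳ (⟦ g ⟧ (e′ ∷ n′ ∷ N ∷ t ∷ [])))
      other-block : ∀ {n′} → n′ < T → n′ ≢ n → sumBelow k (λ e′ → G n′ e′) ≡ 0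
      other-block _ n′≢n = sumBelow-zero k (λ e′<k →
        G≡0 e′<k (λ pos≡ → n′≢n (proj₁ (pos-injective e′<k e<k (trans pos≡ (sym pos≡t))))))
      other-offset : ∀ {e′} → e′ < k → e′ ≢ e → G n e′ ≡ 0
      other-offset e′<k e′≢e = G≡0 e′<k (λ pos≡ → e′≢e (proj₂ (pos-injective e′<k e<k (trans pos≡ (sym pos≡t)))))

    hits-block : ∀ {t} → Block t → hits t ≡ 1
    hits-block = overBlocks-at (lit 1)

    isZero-hits+hits≡1 : ∀ t → isZero (hits t) + hits t ≡ 1
    isZero-hits+hits≡1 t with hits t ≟ 0
    ... | yes hits≡0 = cong (λ h → isZero h + h) hits≡0
    ... | no  hits≢0 = cong (λ h → isZero h + h) (hits-block (hits≢0⇒Block hits≢0))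

    total-hits : sumBelow K hits ≡ T * k
    total-hits = begin
      sumBelow K (λ t → sumBelow T (λ n → sumBelow k (λ e → 1 * δ (pos n e) t)))
        ≡⟨ sumBelow-comm K T _ ⟩
      sumBelow T (λ n → sumBelow K (λ t → sumBelow k (λ e → 1 * δ (pos n e) t)))
        ≡⟨ sumBelow-cong T (λ {n} _ → sumBelow-comm K k (λ t e → 1 * δ (pos n e) t)) ⟩
      sumBelow T (λ n → sumBelow k (λ e → sumBelow K (λ t → 1 * δ (pos n e) t)))
        ≡⟨ sumBelow-cong T (λ n<T → sumBelow-cong k (λ e<k → hit-once n<T e<k)) ⟩
      sumBelow T (λ _ → sumBelow k (λ _ → 1))
        ≡⟨ sumBelow-cong T (λ _ → trans (sumBelow-const k 1) (*-identityʳ k)) ⟩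
      sumBelow T (λ _ → k)
        ≡⟨ sumBelow-const T k ⟩
      T * k
        ∎
      where
      open ≡-Reasoning
      hit-once : ∀ {n e} → n < T → e < k → sumBelow K (λ t → 1 * δ (pos n e) t) ≡ 1
      hit-once {n} {e} n<T e<k =
        trans (sumBelow-single K (pos<K n<T e<k) (λ _ t≢pos → cong (1 *_) (δ-≢ (≢-sym t≢pos))))
              (cong (1 *_) (δ-refl (pos n e)))

    free+T*k≡K : free K + T * k ≡ K
    free+T*k≡K = begin
      free K + T * k                              ≡⟨ cong (free K +_) total-hits ⟨
      free K + sumBelow K hits                    ≡⟨ sumBelow-distrib-+ K (λ t → isZero (hits t)) hits ⟨
      sumBelow K (λ t → isZero (hits t) + hits t) ≡⟨ sumBelow-cong K (λ {t} _ → isZero-hits+hits≡1 t) ⟩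
      sumBelow K (λ _ → 1)                        ≡⟨ trans (sumBelow-const K 1) (*-identityʳ K) ⟩
      K                                           ∎
      where open ≡-Reasoning

module Encoding (k : ℕ) (τᵗ : Term 1) (posᵗ : Term 2) (N : ℕ) (α : ℕ → Bool) where

  open Decompressor k τᵗ posᵗ
  open Layout k τᵗ posᵗ N

  keepIfFree : ℕ → Bool → List Bool
  keepIfFree zero    b = b ∷ []
  keepIfFree (suc _) _ = []

  literals : ℕ → List Bool
  literals zero    = []
  literals (suc t) = literals t ++ keepIfFree (hits t) (α t)

  length-literals : ∀ t → length (literals t) ≡ free t
  length-literals zero    = refl
  length-literals (suc t) = trans (length-++ (literals t)) (cong₂ _+_ (length-literals t) (length-keep (hits t)))
    where
    length-keep : ∀ h → length (keepIfFree h (α t)) ≡ isZero h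
    length-keep zero    = refl
    length-keep (suc _) = refl

  literals-extend : ∀ t o → ∃ λ X → literals (o + t) ≡ literals t ++ X
  literals-extend t zero    = [] , sym (++-identityʳ (literals t))
  literals-extend t (suc o) with literals-extend t o
  ... | X , literals≡ = X ++ keepIfFree (hits (o + t)) (α (o + t)) ,
                        trans (cong (_++ keepIfFree (hits (o + t)) (α (o + t))) literals≡) (++-assoc (literals t) X _)

  literals-split : ∀ {t u} → t < u → hits t ≡ 0 → ∃ λ X → literals u ≡ literals t ++ α t ∷ X
  literals-split {t} t<u hits≡0 with m≤n⇒∃[o]m+o≡n t<u
  ... | o , refl with literals-extend (suc t) o
  ...   | X , literals≡ = X , (begin
    literals (suc t + o)                           ≡⟨ cong literals (+-comm (suc t) o) ⟩
    literals (o + suc t)                           ≡⟨ literals≡ ⟩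
    (literals t ++ keepIfFree (hits t) (α t)) ++ X ≡⟨ cong (λ h → (literals t ++ keepIfFree h (α t)) ++ X) hits≡0 ⟩
    (literals t ++ α t ∷ []) ++ X                  ≡⟨ ++-assoc (literals t) (α t ∷ []) X ⟩
    literals t ++ α t ∷ X                          ∎)
    where open ≡-Reasoning

  bitAt-literals : ∀ {t u} s → t < u → hits t ≡ 0 → bitAt (literals u ++ s) (free t) ≡ α t
  bitAt-literals {t} {u} s t<u hits≡0 with literals-split t<u hits≡0
  ... | X , literals≡ = begin
    bitAt (literals u ++ s) (free t)                         ≡⟨ cong (λ ys → bitAt (ys ++ s) (free t)) literals≡ ⟩
    bitAt ((literals t ++ α t ∷ X) ++ s) (free t)            ≡⟨ cong (λ ys → bitAt ys (free t)) (++-assoc (literals t) (α t ∷ X) s) ⟩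
    bitAt (literals t ++ α t ∷ X ++ s) (free t)              ≡⟨ cong (bitAt (literals t ++ α t ∷ X ++ s)) (length-literals t) ⟨
    bitAt (literals t ++ α t ∷ X ++ s) (length (literals t)) ≡⟨ bitAt-++ (literals t) ⟩
    α t                                                      ∎
    where open ≡-Reasoning

  module Mismatch (τ : ℕ → Bool) (τᵗ-correct : ComputesBits k τᵗ τ) (pos-injective : DisjointBlocks k posᵗ)
                  (mismatch : ∀ {n} → n < T → ∃ λ e → e < k × α (pos n e) ≢ τ e) where

    open Injective pos-injective

    j w D : ℕ
    j = 2 + (N + N)
    w = ⟦ widthᵗ (var (# 0)) ⟧ (N ∷ [])
    D = 2 ^ k ∸ 1

    T≡2^k*j : T ≡ 2 ^ k * j
    T≡2^k*j = cong (_* j) (prodBelow-const k 2)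

    1≤k : 1 ≤ k
    1≤k with mismatch (subst (0 <_) (sym T≡2^k*j) (>-nonZero⁻¹ (2 ^ k * j) {{m*n≢0 (2 ^ k) j {{m^n≢0 2 k}}}}))
    ... | e , e<k , _ = ≤-trans (s≤s z≤n) e<k

    instance
      D≢0 : NonZero D
      D≢0 = >-nonZero (∸-monoˡ-≤ 1 (^-monoʳ-≤ 2 1≤k))

    -- block n is recorded by its differences from τ, read as a binary number in [1, 2ᵏ)
    difference : ℕ → ℕ → Bool
    difference n e = τ e xor α (pos n e)

    value : ℕ → ℕ
    value n = sumBelow k (λ e → bit (difference n e) * 2 ^ e)

    1≤value : ∀ {n} → n < T → 1 ≤ value n
    1≤value {n} n<T with mismatch n<T
    ... | e , e<k , α≢τ = begin
      1                            ≤⟨ m^n>0 2 e ⟩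
      2 ^ e                        ≡⟨ trans (cong (λ b → bit b * 2 ^ e) (xor-≢ α≢τ)) (*-identityˡ (2 ^ e)) ⟨
      bit (difference n e) * 2 ^ e ≤⟨ term≤sumBelow k (λ e → bit (difference n e) * 2 ^ e) e<k ⟩
      value n                      ∎
      where open ≤-Reasoning

    blockDigit : ℕ → ℕ
    blockDigit n = value n ∸ 1

    blockDigit<D : ∀ {n} → n < T → blockDigit n < D
    blockDigit<D {n} n<T = ∸-monoˡ-< (digits< 2 k (λ e → bit (difference n e)) (λ _ → bit<2 _)) (1≤value n<T)

    R : ℕ
    R = sumBelow T (λ n → blockDigit n * D ^ n)

    R<2^w : R < 2 ^ w
    R<2^w = ≤-trans (digits< D T blockDigit blockDigit<D)
                    (subst (λ T′ → D ^ T′ ≤ 2 ^ (k * T′ ∸ j)) (sym T≡2^k*j) (blocks≤bits k j 1≤k))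

    encodedBlocks rest input : List Bool
    encodedBlocks = proj₁ (numeral w R R<2^w)
    rest  = literals K ++ encodedBlocks
    input = replicate N true ++ false ∷ rest

    leadingOnes-input : leadingOnes input ≡ N
    leadingOnes-input = go N
      where
      go : ∀ M → leadingOnes (replicate M true ++ false ∷ rest) ≡ M
      go zero    = refl
      go (suc M) = cong suc (go M)

    drop-input : drop (N + 1) input ≡ rest
    drop-input = go N
      where
      go : ∀ M → drop (M + 1) (replicate M true ++ false ∷ rest) ≡ rest
      go zero    = refl
      go (suc M) = go M

    length-input : length input ≡ N + 1 + restLength N
    length-input = begin
      length input                                  ≡⟨ length-++ (replicate N true) ⟩
      length (replicate N true) + suc (length rest) ≡⟨ cong₂ (λ a b → a + suc b) (length-replicate N) length-rest ⟩
      N + suc (restLength N)                        ≡⟨ +-suc N (restLength N) ⟩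
      suc N + restLength N                          ≡⟨ cong (_+ restLength N) (+-comm 1 N) ⟩
      N + 1 + restLength N                          ∎
      where
      open ≡-Reasoning
      length-rest : length rest ≡ restLength N
      length-rest = trans (length-++ (literals K)) (cong₂ _+_ (length-literals K) (proj₁ (proj₂ (numeral w R R<2^w))))

    input-wellFormed : WellFormed input
    input-wellFormed = trans length-input (cong (λ M → M + 1 + restLength M) (sym leadingOnes-input))

    r : ℕ
    r = code rest

    number-correct : ⟦ numberᵗ (var (# 0)) (var (# 1)) ⟧ (r ∷ N ∷ []) ≡ R
    number-correct = begin
      ⟦ dropᵗ (freeᵗ (var (# 1)) (outLengthᵗ (var (# 1)))) (var (# 0)) ⟧ (r ∷ N ∷ []) + 1
        ∸ ⟦ powᵗ (lit 2) (widthᵗ (var (# 1))) ⟧ (r ∷ N ∷ [])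
        ≡⟨ cong₂ (λ a b → a + 1 ∸ b) (dropᵗ-correct (freeᵗ (var (# 1)) (outLengthᵗ (var (# 1)))) (var (# 0)) (r ∷ N ∷ []) refl)
                                      (powᵗ-correct (lit 2) (widthᵗ (var (# 1))) (r ∷ N ∷ [])) ⟩
      code (drop (free K) rest) + 1 ∸ 2 ^ w
        ≡⟨ cong (λ s → code (drop s rest) + 1 ∸ 2 ^ w) (length-literals K) ⟨
      code (drop (length (literals K)) rest) + 1 ∸ 2 ^ w
        ≡⟨ cong (λ s → code s + 1 ∸ 2 ^ w) (drop-++ (literals K) encodedBlocks) ⟩
      code encodedBlocks + 1 ∸ 2 ^ w
        ≡⟨ cong (_∸ 2 ^ w) (proj₂ (proj₂ (numeral w R R<2^w))) ⟩
      R + 2 ^ w ∸ 2 ^ w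
        ≡⟨ m+n∸n≡m R (2 ^ w) ⟩
      R ∎
      where open ≡-Reasoning

    blockBit-correct : ∀ {t} → Block t → ⟦ blockBitᵗ (var (# 1)) (var (# 2)) (var (# 0)) ⟧ (t ∷ r ∷ N ∷ []) ≡ bit (α t)
    blockBit-correct {t} b@(n , e , n<T , e<k , pos≡t) = begin
      ⟦ blockBitᵗ (var (# 1)) (var (# 2)) (var (# 0)) ⟧ ctx
        ≡⟨ xorᵗ-correct (app τᵗ (offset₃ ∷ [])) (digitᵗ value₃ (lit 2) offset₃) ctx τ-at-offset difference-at-offset ⟩
      bit (τ e xor difference n e)                                   ≡⟨ cong bit (xor-cancelˡ (τ e) (α (pos n e))) ⟩
      bit (α (pos n e))                                     ≡⟨ cong (λ t → bit (α t)) pos≡t ⟩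
      bit (α t)                                             ∎
      where
      open ≡-Reasoning
      ctx = t ∷ r ∷ N ∷ []
      offset₃ block₃ number₃ D₃ value₃ : Term 3
      offset₃ = offsetᵗ (var (# 2)) (var (# 0))
      block₃  = blockᵗ (var (# 2)) (var (# 0))
      number₃ = numberᵗ (var (# 1)) (var (# 2))
      D₃      = monus (powᵗ (lit 2) (lit k)) (lit 1)
      value₃  = add (digitᵗ number₃ D₃ block₃) (lit 1)
      offset≡e : ⟦ offset₃ ⟧ ctx ≡ e
      offset≡e = overBlocks-at (var (# 0)) b
      τ-at-offset : ⟦ app τᵗ (offset₃ ∷ []) ⟧ ctx ≡ bit (τ e)
      τ-at-offset = trans (cong (λ e′ → ⟦ τᵗ ⟧ (e′ ∷ [])) offset≡e) (τᵗ-correct e<k)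
      value-of-block : ⟦ value₃ ⟧ ctx ≡ value n
      value-of-block = trans (cong (_+ 1) (trans (digitᵗ-correct number₃ D₃ block₃ ctx number-correct
                                                                 (cong (_∸ 1) (powᵗ-correct (lit 2) (lit k) ctx))
                                                                 (overBlocks-at (var (# 1)) b))
                                                 (digit D T blockDigit blockDigit<D n<T)))
                             (m∸n+n≡m (1≤value n<T))
      difference-at-offset : ⟦ digitᵗ value₃ (lit 2) offset₃ ⟧ ctx ≡ bit (difference n e)
      difference-at-offset = trans (digitᵗ-correct value₃ (lit 2) offset₃ ctx value-of-block refl offset≡e)
                                  (digit 2 k (λ e → bit (difference n e)) (λ _ → bit<2 _) e<k)

    outBit-correct : ∀ {t} → t < K → ⟦ outBitᵗ (var (# 1)) (var (# 2)) (var (# 0)) ⟧ (t ∷ r ∷ N ∷ []) ≡ bit (α t)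
    outBit-correct {t} t<K = by-hits (hits t ≟ 0)
      where
      ctx = t ∷ r ∷ N ∷ []
      literal = ⟦ bitAtᵗ (var (# 1)) (freeᵗ (var (# 2)) (var (# 0))) ⟧ ctx
      block   = ⟦ blockBitᵗ (var (# 1)) (var (# 2)) (var (# 0)) ⟧ ctx
      by-hits : Dec (hits t ≡ 0) → ifZero (hits t) literal block ≡ bit (α t)
      by-hits (yes hits≡0) = trans (ifZero-zero literal block hits≡0)
                                   (trans (bitAtᵗ-correct (var (# 1)) (freeᵗ (var (# 2)) (var (# 0))) ctx refl)
                                          (cong bit (bitAt-literals encodedBlocks t<K hits≡0)))
      by-hits (no hits≢0) = trans (ifZero-suc literal block (hits-block (hits≢0⇒Block hits≢0)))
                                  (blockBit-correct (hits≢0⇒Block hits≢0))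

    output-rest : ⟦ outputᵗ ⟧ (code input ∷ []) ≡ ⟦ decode₂ ⟧ (r ∷ N ∷ [])
    output-rest = cong₂ (λ r′ N′ → ⟦ decode₂ ⟧ (r′ ∷ N′ ∷ [])) rest≡ lead≡
      where
      lead≡ : ⟦ leadingOnesᵗ (var (# 0)) ⟧ (code input ∷ []) ≡ N
      lead≡ = trans (leadingOnesᵗ-correct (var (# 0)) (code input ∷ []) refl) leadingOnes-input
      rest≡ : ⟦ dropᵗ (add (leadingOnesᵗ (var (# 0))) (lit 1)) (var (# 0)) ⟧ (code input ∷ []) ≡ r
      rest≡ = trans (dropᵗ-correct (add (leadingOnesᵗ (var (# 0))) (lit 1)) (var (# 0)) (code input ∷ []) refl)
                    (trans (cong (λ M → code (drop (M + 1) input)) lead≡) (cong code drop-input))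

    decode-rest : ⟦ decode₂ ⟧ (r ∷ N ∷ []) ≡ sumBelow K (λ t → 2 ^ t * (bit (α t) + 1))
    decode-rest = trans (decode₂-sum r N) (sumBelow-cong K (λ {t} t<K →
      cong₂ (λ a b → a * (b + 1)) (powᵗ-correct (lit 2) (var (# 0)) (t ∷ r ∷ N ∷ [])) (outBit-correct t<K)))

    output-correct : ⟦ outputᵗ ⟧ (code input ∷ []) ≡ code (prefix α K)
    output-correct = trans output-rest (trans decode-rest (sym (code-prefix α K)))

    K≡restLength+j : K ≡ restLength N + j
    K≡restLength+j = begin
      K                        ≡⟨ free+T*k≡K ⟨
      free K + T * k           ≡⟨ cong (free K +_) (*-comm T k) ⟩
      free K + k * T           ≡⟨ cong (free K +_) (m∸n+n≡m j≤kT) ⟨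
      free K + (k * T ∸ j + j) ≡⟨ +-assoc (free K) (k * T ∸ j) j ⟨
      restLength N + j         ∎
      where
      open ≡-Reasoning
      j≤kT : j ≤ k * T
      j≤kT = ≤-trans (m≤n*m j (2 ^ k) {{m^n≢0 2 k}})
                     (≤-trans (≤-reflexive (sym T≡2^k*j)) (m≤n*m T k {{>-nonZero 1≤k}}))

-- KC-strings meet every computable pattern

module Pattern (k : ℕ) (τ : ℕ → Bool) (τᵗ : Term 1) (τᵗ-correct : ComputesBits k τᵗ τ)
               (posᵗ : Term 2) (pos-injective : DisjointBlocks k posᵗ) (α : ℕ → Bool) where

  open Decompressor k τᵗ posᵗ

  pos : ℕ → ℕ → ℕ
  pos n e = ⟦ posᵗ ⟧ (n ∷ e ∷ [])

  Matches Mismatches : ℕ → Set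
  Matches n    = ∀ {e} → e < k → α (pos n e) ≡ τ e
  Mismatches n = ∃ λ e → e < k × α (pos n e) ≢ τ e

  matches? : ∀ n → Matches n ⊎ Mismatches n
  matches? n with anyUpTo? (λ e → ¬? (α (pos n e) Bool.≟ τ e)) k
  ... | yes mismatch  = inj₂ mismatch
  ... | no  ¬mismatch = inj₁ (λ {e} e<k →
    decidable-stable (α (pos n e) Bool.≟ τ e) (λ α≢τ → ¬mismatch (e , e<k , α≢τ)))

  search : ∀ T → (∃ λ n → Matches n) ⊎ (∀ {n} → n < T → Mismatches n)
  search T with anyUpTo? (λ n → Dec-matches n) T
    where
    Dec-matches : ∀ n → Dec (Matches n)
    Dec-matches n with matches? n
    ... | inj₁ match            = yes match
    ... | inj₂ (e , e<k , α≢τ) = no (λ match → α≢τ (match e<k))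
  ... | yes (n , _ , match) = inj₁ (n , match)
  ... | no  none = inj₂ (λ {n} n<T → mismatch n n<T)
    where
    mismatch : ∀ n → n < T → Mismatches n
    mismatch n n<T with matches? n
    ... | inj₁ match    = ⊥-elim (none (n , n<T , match))
    ... | inj₂ mismatch = mismatch

  Compression : ℕ → Set
  Compression N = ∃₂ λ p K → V ⟨ p ⟩↓ prefix α K × length p + N + 1 ≡ K

  compress : ∀ N → (∀ {n} → n < Layout.T k τᵗ posᵗ N → Mismatches n) → Compression N
  compress N mismatch = input , K , V-run input-wellFormed output-correct , (begin
    length input + N + 1                          ≡⟨ cong (λ l → l + N + 1) length-input ⟩
    N + 1 + restLength N + N + 1                  ≡⟨ regroup N (restLength N) ⟩
    restLength N + (2 + (N + N))                  ≡⟨ K≡restLength+j ⟨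
    K                                             ∎)
    where
    open Layout k τᵗ posᵗ N
    open Encoding k τᵗ posᵗ N α
    open Mismatch τ τᵗ-correct pos-injective mismatch
    open ≡-Reasoning
    regroup : ∀ N L → N + 1 + L + N + 1 ≡ L + (2 + (N + N))
    regroup = solve-∀

  pattern-or-compression : ∀ N → (∃ λ n → Matches n) ⊎ Compression N
  pattern-or-compression N with search (Layout.T k τᵗ posᵗ N)
  ... | inj₁ found    = inj₁ found
  ... | inj₂ mismatch = inj₂ (compress N mismatch)

MeetsPatterns : (ℕ → Bool) → Set
MeetsPatterns α = ∀ k (τ : ℕ → Bool) (τᵗ : Term 1) → ComputesBits k τᵗ τ →
                  ∀ (posᵗ : Term 2) → DisjointBlocks k posᵗ →
                  ∃ λ n → ∀ {e} → e < k → α (⟦ posᵗ ⟧ (n ∷ e ∷ [])) ≡ τ e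

KCString⇒MeetsPatterns : ∀ {U α} → UniversalPrefix U → KCString U α → MeetsPatterns α
KCString⇒MeetsPatterns {U} {α} (_ , universal) (m , incompressible) k τ τᵗ τᵗ-correct posᵗ pos-injective =
  fromInj₁ (⊥-elim ∘ too-short) (pattern-or-compression N)
  where
  open Decompressor k τᵗ posᵗ
  open Pattern k τ τᵗ τᵗ-correct posᵗ pos-injective α
  q = proj₁ (universal V V-prefixFree)
  N = length q + m
  too-short : ¬ Compression N
  too-short (p , K , V↓ , |p|+N+1≡K) = 1+n≰n (begin
    suc (length p + N)      ≡⟨ +-comm 1 (length p + N) ⟩
    length p + N + 1        ≡⟨ |p|+N+1≡K ⟩
    K                       ≤⟨ incompressible K (q ++ p) (proj₂ (proj₂ (universal V V-prefixFree) p (prefix α K)) V↓) ⟩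
    length (q ++ p) + m     ≡⟨ cong (_+ m) (length-++ q) ⟩
    length q + length p + m ≡⟨ regroup (length q) (length p) m ⟩
    length p + N            ∎)
    where
    open ≤-Reasoning
    regroup : ∀ a b c → a + b + c ≡ b + (a + c)
    regroup = solve-∀

-- The extension axioms

nth : ∀ {A : Set} → A → List A → ℕ → A
nth d []       _       = d
nth d (x ∷ xs) zero    = x
nth d (x ∷ xs) (suc e) = nth d xs e

nth-∈ : ∀ {A : Set} {d : A} xs {e} → e < length xs → nth d xs e ∈ xs
nth-∈ (x ∷ xs) {zero}  _         = here refl
nth-∈ (x ∷ xs) {suc e} (s≤s e<) = there (nth-∈ xs e<)

∈⇒nth : ∀ {A : Set} {d : A} {x} xs → x ∈ xs → ∃ λ e → e < length xs × nth d xs e ≡ x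
∈⇒nth (x ∷ xs) (here refl) = 0 , s≤s z≤n , refl
∈⇒nth (y ∷ xs) (there x∈) with ∈⇒nth xs x∈
... | e , e< , nth≡x = suc e , s≤s e< , nth≡x

nth-map : ∀ {A B : Set} (f : A → B) {d d′} xs {e} → e < length xs → nth d′ (map f xs) e ≡ f (nth d xs e)
nth-map f (x ∷ xs) {zero}  _         = refl
nth-map f (x ∷ xs) {suc e} (s≤s e<) = nth-map f xs e<

nth-injective : ∀ {A : Set} {d : A} {xs} → Unique xs → ∀ {e e′} → e < length xs → e′ < length xs →
                nth d xs e ≡ nth d xs e′ → e ≡ e′
nth-injective {xs = _ ∷ xs} (x∉ ∷ _) {zero}  {zero}   _        _         _  = refl
nth-injective {xs = _ ∷ xs} (x∉ ∷ _) {zero}  {suc e′} _        (s≤s e′<) x≡ = ⊥-elim (All.lookup x∉ (nth-∈ xs e′<) x≡)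
nth-injective {xs = _ ∷ xs} (x∉ ∷ _) {suc e} {zero}   (s≤s e<) _         ≡x = ⊥-elim (All.lookup x∉ (nth-∈ xs e<) (sym ≡x))
nth-injective {xs = _ ∷ _}  (_ ∷ unique) {suc e} {suc e′} (s≤s e<) (s≤s e′<) eq = cong suc (nth-injective unique e< e′< eq)

selectᵗ : ∀ {n} → List (Term n) → Term n → Term n
selectᵗ []       e = lit 0
selectᵗ (t ∷ ts) e = if0 e t (selectᵗ ts (monus e (lit 1)))

selectᵗ-correct : ∀ {n} ts (e : Term n) xs → ⟦ selectᵗ ts e ⟧ xs ≡ ⟦ nth (lit 0) ts (⟦ e ⟧ xs) ⟧ xs
selectᵗ-correct ts e xs = go ts e refl
  where
  go : ∀ ts e {i} → ⟦ e ⟧ xs ≡ i → ⟦ selectᵗ ts e ⟧ xs ≡ ⟦ nth (lit 0) ts i ⟧ xs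
  go []       e _               = refl
  go (t ∷ ts) e {zero}  e≡0     = ifZero-zero (⟦ t ⟧ xs) (⟦ selectᵗ ts (monus e (lit 1)) ⟧ xs) e≡0
  go (t ∷ ts) e {suc i} e≡1+i   = trans (ifZero-suc (⟦ t ⟧ xs) (⟦ selectᵗ ts (monus e (lit 1)) ⟧ xs) e≡1+i)
                                        (go ts (monus e (lit 1)) (cong (_∸ 1) e≡1+i))

clamp : ∀ {n} → ℕ → Fin (suc n)
clamp {n} a with a <? suc n
... | yes a< = fromℕ< a<
... | no  _  = fzero

toℕ-clamp : ∀ {n a} → a < suc n → toℕ (clamp {n} a) ≡ a
toℕ-clamp {n} {a} a< with a <? suc n
... | yes a<′ = toℕ-fromℕ< a<′
... | no  a≮  = ⊥-elim (a≮ a<)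

hasSecond : ∀ {A : Set} → List (A × ℕ) → ℕ → Bool
hasSecond xs m = does (any? (λ x → proj₂ x ℕ.≟ m) xs)

hasSecond-∈ : ∀ {A : Set} {xs : List (A × ℕ)} {x} → x ∈ xs → hasSecond xs (proj₂ x) ≡ true
hasSecond-∈ {xs = xs} {x} x∈ with any? (λ y → proj₂ y ℕ.≟ proj₂ x) xs
... | yes _    = refl
... | no  none = ⊥-elim (none (lose x∈ refl))

hasSecond⇒∈ : ∀ {A : Set} {xs : List (A × ℕ)} {m} → hasSecond xs m ≡ true → ∃ λ x → x ∈ xs × proj₂ x ≡ m
hasSecond⇒∈ {xs = xs} {m} has with any? (λ y → proj₂ y ℕ.≟ m) xs
... | yes some = find some

module Extension (ℓ′ : ℕ) (ψ : Fin (suc ℓ′) → ℕ → ℕ → ℕ) (ψ-computable : Recursive3 ψ)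
                 (ψ-injective : ∀ i n m i′ n′ m′ → ψ i n m ≡ ψ i′ n′ m′ → (i ≡ i′) × (n ≡ n′) × (m ≡ m′))
                 (α : ℕ → Bool) (meets : MeetsPatterns α) where

  ℓ : ℕ
  ℓ = suc (suc ℓ′)

  ψ₂ : Fin (suc ℓ′) → Vec ℕ 2 → ℕ
  ψ₂ i (a ∷ b ∷ []) = ψ i a b

  ψ₂ᴾ : Fin (suc ℓ′) → PR 2
  ψ₂ᴾ i = comp (proj₁ ψ-computable) (constᴾ (toℕ i) ∷ proj (# 0) ∷ proj (# 1) ∷ [])

  ψ₂ᴾ-correct : ∀ i xs → Eval (ψ₂ᴾ i) xs (ψ₂ i xs)
  ψ₂ᴾ-correct i (a ∷ b ∷ []) =
    ev-comp (ev-∷ (constᴾ-correct _ _) (ev-∷ ev-proj (ev-∷ ev-proj ev-[]))) (proj₂ ψ-computable i a b)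

  ψᵗ : ∀ {n} → Fin (suc ℓ′) → Term n → Term n → Term n
  ψᵗ i a b = call (ψ₂ᴾ i) (ψ₂ i) (ψ₂ᴾ-correct i) (a ∷ b ∷ [])

  same-point : ∀ {x y : Carrier ℓ} → toℕ (proj₁ x) ≡ toℕ (proj₁ y) → proj₂ x ≡ proj₂ y → x ≡ y
  same-point {_ , _} {_ , _} level≡ second≡ = cong₂ _,_ (toℕ-injective level≡) second≡

  hasSecond-disjoint : ∀ {A B : List (Carrier ℓ)} → Disjoint A B →
                       (∀ {a b} → a ∈ A → b ∈ B → toℕ (proj₁ a) ≡ toℕ (proj₁ b)) →
                       ∀ {b} → b ∈ B → hasSecond A (proj₂ b) ≢ true
  hasSecond-disjoint A#B same-level b∈ has with hasSecond⇒∈ has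
  ... | a , a∈ , second≡ = A#B a a∈ (subst (_∈ _) (sym (same-point (same-level a∈ b∈) second≡)) b∈)

  module Witness (i : Fin ℓ) (X Y Z X′ Y′ : List (Carrier ℓ))
    (X-above : All (AtLevel ℓ (Level ℓ) (suc (toℕ i))) X) (Y-above : All (AtLevel ℓ (Level ℓ) (suc (toℕ i))) Y)
    (X#Y : Disjoint X Y) (_ : All (Level ℓ i) Z)
    (X′-below : All (BelowLevel ℓ (Level ℓ) i) X′) (Y′-below : All (BelowLevel ℓ (Level ℓ) i) Y′)
    (X′#Y′ : Disjoint X′ Y′) where

    -- a key (true , m) asks for an edge z → (i + 1, m), a key (false , m) for an edge (i − 1, m) → z
    Key : Set
    Key = Bool × ℕ

    upKey downKey : Carrier ℓ → Key
    upKey   x = true , proj₂ x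
    downKey x = false , proj₂ x

    keys : List Key
    keys = deduplicate (≡-dec Bool._≟_ ℕ._≟_) (map upKey (X ++ Y) ++ map downKey (X′ ++ Y′))

    k : ℕ
    k = length keys

    wanted : Key → Bool
    wanted (true  , m) = hasSecond X m
    wanted (false , m) = hasSecond X′ m

    n₀ : ℕ
    n₀ = suc (max 0 (map proj₂ ((X ++ Y) ++ (X′ ++ Y′) ++ Z)))

    fresh : ∀ {x} → x ∈ (X ++ Y) ++ (X′ ++ Y′) ++ Z → proj₂ x < n₀
    fresh x∈ = s≤s (All.lookup (xs≤max 0 _) (∈-map⁺ proj₂ x∈))

    key<n₀ : ∀ {c} → c ∈ keys → proj₂ c < n₀
    key<n₀ c∈ with ∈-++⁻ (map upKey (X ++ Y)) (∈-deduplicate⁻ _ _ c∈)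
    ... | inj₁ c∈up   with ∈-map⁻ upKey c∈up
    ...   | x , x∈ , refl = fresh (∈-++⁺ˡ x∈)
    key<n₀ c∈ | inj₂ c∈down with ∈-map⁻ downKey c∈down
    ...   | x , x∈ , refl = fresh (∈-++⁺ʳ (X ++ Y) (∈-++⁺ˡ x∈))

    up down : Fin (suc ℓ′)
    up   = clamp (toℕ i)
    down = clamp (pred (toℕ i))

    position : Key → ℕ → ℕ
    position (true  , m) n = ψ up (n₀ + n) m
    position (false , m) n = ψ down m (n₀ + n)

    positionᵗ : Key → Term 2
    positionᵗ (true  , m) = ψᵗ up (add (lit n₀) (var (# 0))) (lit m)
    positionᵗ (false , m) = ψᵗ down (lit m) (add (lit n₀) (var (# 0)))

    positionᵗ-correct : ∀ c n e → ⟦ positionᵗ c ⟧ (n ∷ e ∷ []) ≡ position c n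
    positionᵗ-correct (true  , m) n e = refl
    positionᵗ-correct (false , m) n e = refl

    -- keys below n₀ never collide with the fresh indices n₀ + n
    position-injective : ∀ c c′ {n n′} → proj₂ c < n₀ → proj₂ c′ < n₀ →
                         position c n ≡ position c′ n′ → n ≡ n′ × c ≡ c′
    position-injective (true , m) (true , m′) _ _ eq with ψ-injective _ _ _ _ _ _ eq
    ... | _ , n₀+n≡ , m≡ = +-cancelˡ-≡ n₀ _ _ n₀+n≡ , cong (true ,_) m≡
    position-injective (false , m) (false , m′) _ _ eq with ψ-injective _ _ _ _ _ _ eq
    ... | _ , m≡ , n₀+n≡ = +-cancelˡ-≡ n₀ _ _ n₀+n≡ , cong (false ,_) m≡
    position-injective (true , m) (false , m′) {n = n} _ m′<n₀ eq with ψ-injective _ _ _ _ _ _ eq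
    ... | _ , n₀+n≡m′ , _ = ⊥-elim (<-irrefl (sym n₀+n≡m′) (<-≤-trans m′<n₀ (m≤m+n n₀ n)))
    position-injective (false , m) (true , m′) {n′ = n′} m<n₀ _ eq with ψ-injective _ _ _ _ _ _ eq
    ... | _ , m≡n₀+n′ , _ = ⊥-elim (<-irrefl m≡n₀+n′ (<-≤-trans m<n₀ (m≤m+n n₀ n′)))

    upKey∈keys : ∀ {x} → x ∈ X ++ Y → upKey x ∈ keys
    upKey∈keys x∈ = ∈-deduplicate⁺ (≡-dec Bool._≟_ ℕ._≟_) (∈-++⁺ˡ (∈-map⁺ upKey x∈))

    downKey∈keys : ∀ {x} → x ∈ X′ ++ Y′ → downKey x ∈ keys
    downKey∈keys x∈ = ∈-deduplicate⁺ (≡-dec Bool._≟_ ℕ._≟_) (∈-++⁺ʳ (map upKey (X ++ Y)) (∈-map⁺ downKey x∈))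

    default : Key
    default = true , 0

    τ : ℕ → Bool
    τ e = wanted (nth default keys e)

    τᵗ : Term 1
    τᵗ = selectᵗ (map (λ c → lit (bit (wanted c))) keys) (var (# 0))

    τᵗ-correct : ComputesBits k τᵗ τ
    τᵗ-correct {e} e<k = trans (selectᵗ-correct (map (λ c → lit (bit (wanted c))) keys) (var (# 0)) (e ∷ []))
                               (cong (λ t → ⟦ t ⟧ (e ∷ [])) (nth-map (λ c → lit (bit (wanted c))) {default} {lit 0} keys e<k))

    posᵗ : Term 2
    posᵗ = selectᵗ (map positionᵗ keys) (var (# 1))

    posᵗ-correct : ∀ {n e} → e < k → ⟦ posᵗ ⟧ (n ∷ e ∷ []) ≡ position (nth default keys e) n
    posᵗ-correct {n} {e} e<k = trans (selectᵗ-correct (map positionᵗ keys) (var (# 1)) (n ∷ e ∷ []))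
      (trans (cong (λ t → ⟦ t ⟧ (n ∷ e ∷ [])) (nth-map positionᵗ {default} {lit 0} keys e<k))
             (positionᵗ-correct (nth default keys e) n e))

    posᵗ-injective : DisjointBlocks k posᵗ
    posᵗ-injective {e = e} {e′ = e′} e<k e′<k eq
      with position-injective (nth default keys e) (nth default keys e′)
                              (key<n₀ (nth-∈ keys e<k)) (key<n₀ (nth-∈ keys e′<k))
                              (trans (sym (posᵗ-correct e<k)) (trans eq (posᵗ-correct e′<k)))
    ... | n≡n′ , key≡ =
      n≡n′ , nth-injective (deduplicate-! (map upKey (X ++ Y) ++ map downKey (X′ ++ Y′))) e<k e′<k key≡

    occurrence : ∃ λ n → ∀ {e} → e < k → α (⟦ posᵗ ⟧ (n ∷ e ∷ [])) ≡ τ e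
    occurrence = meets k τ τᵗ τᵗ-correct posᵗ posᵗ-injective

    n : ℕ
    n = proj₁ occurrence

    satisfied : ∀ {c} → c ∈ keys → α (position c n) ≡ wanted c
    satisfied c∈ with ∈⇒nth {d = default} keys c∈
    ... | e , e<k , refl = trans (cong α (sym (posᵗ-correct e<k))) (proj₂ occurrence e<k)

    z : Carrier ℓ
    z = i , n₀ + n

    z∉Z : z ∉ Z
    z∉Z z∈ = <-irrefl refl (≤-<-trans (m≤m+n n₀ n) (fresh (∈-++⁺ʳ (X ++ Y) (∈-++⁺ʳ (X′ ++ Y′) z∈))))

    level-above : ∀ {x} → x ∈ X ++ Y → toℕ (proj₁ x) ≡ suc (toℕ i)
    level-above x∈ with ∈-++⁻ X x∈
    ... | inj₁ x∈X with All.lookup X-above x∈X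
    ...   | _ , level≡ , refl = level≡
    level-above x∈ | inj₂ x∈Y with All.lookup Y-above x∈Y
    ...   | _ , level≡ , refl = level≡

    level-below : ∀ {x} → x ∈ X′ ++ Y′ → suc (toℕ (proj₁ x)) ≡ toℕ i
    level-below x∈ with ∈-++⁻ X′ x∈
    ... | inj₁ x∈X′ with All.lookup X′-below x∈X′
    ...   | _ , level≡ , refl = level≡
    level-below x∈ | inj₂ x∈Y′ with All.lookup Y′-below x∈Y′
    ...   | _ , level≡ , refl = level≡

    toℕ-up : ∀ {x} → x ∈ X ++ Y → toℕ up ≡ toℕ i
    toℕ-up {x} x∈ = toℕ-clamp (s≤s⁻¹ (subst (_< ℓ) (level-above x∈) (toℕ<n (proj₁ x))))

    toℕ-down : ∀ {x} → x ∈ X′ ++ Y′ → toℕ down ≡ toℕ (proj₁ x)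
    toℕ-down {x} x∈ = trans (toℕ-clamp pred-i<) (cong pred (sym (level-below x∈)))
      where
      pred-i< : pred (toℕ i) < suc ℓ′
      pred-i< = subst (λ a → pred a < suc ℓ′) (level-below x∈) (s≤s⁻¹ (subst (_< ℓ) (sym (level-below x∈)) (toℕ<n i)))

    S : Carrier ℓ → Carrier ℓ → Set
    S = Sα ℓ ψ α

    edge-to-X : ∀ {x} → x ∈ X → S z x
    edge-to-X {x} x∈ = up , sym (toℕ-up x∈X++Y) , trans (level-above x∈X++Y) (cong suc (sym (toℕ-up x∈X++Y))) ,
                       trans (satisfied (upKey∈keys x∈X++Y)) (hasSecond-∈ x∈)
      where x∈X++Y = ∈-++⁺ˡ x∈

    no-edge-to-Y : ∀ {y} → y ∈ Y → ¬ S z y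
    no-edge-to-Y {y} y∈ (i′ , i≡i′ , _ , α≡true) with toℕ-injective (trans (sym i≡i′) (sym (toℕ-up (∈-++⁺ʳ X y∈))))
    ... | refl = hasSecond-disjoint X#Y (λ a∈ b∈ → trans (level-above (∈-++⁺ˡ a∈)) (sym (level-above (∈-++⁺ʳ X b∈))))
                   y∈
                   (trans (sym (satisfied (upKey∈keys (∈-++⁺ʳ X y∈)))) α≡true)

    edge-from-X′ : ∀ {x} → x ∈ X′ → S x z
    edge-from-X′ {x} x∈ = down , sym (toℕ-down x∈X′++Y′) ,
                          trans (sym (level-below x∈X′++Y′)) (cong suc (sym (toℕ-down x∈X′++Y′))) ,
                          trans (satisfied (downKey∈keys x∈X′++Y′)) (hasSecond-∈ x∈)
      where x∈X′++Y′ = ∈-++⁺ˡ x∈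

    no-edge-from-Y′ : ∀ {y} → y ∈ Y′ → ¬ S y z
    no-edge-from-Y′ {y} y∈ (i′ , y≡i′ , _ , α≡true) with toℕ-injective (trans (sym y≡i′) (sym (toℕ-down (∈-++⁺ʳ X′ y∈))))
    ... | refl = hasSecond-disjoint X′#Y′
                   (λ a∈ b∈ → cong pred (trans (level-below (∈-++⁺ˡ a∈)) (sym (level-below (∈-++⁺ʳ X′ b∈))))) y∈
                   (trans (sym (satisfied (downKey∈keys (∈-++⁺ʳ X′ y∈)))) α≡true)

    extension : Σ (Carrier ℓ) λ z → Level ℓ i z × z ∉ Z ×
                  All (λ x → S z x) X × All (λ x′ → S x′ z) X′ × All (λ y → ¬ S z y) Y × All (λ y′ → ¬ S y′ z) Y′
    extension = z , refl , z∉Z , All.tabulate edge-to-X , All.tabulate edge-from-X′ ,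
                All.tabulate no-edge-to-Y , All.tabulate no-edge-from-Y′

  model : ModelT ℓ (Carrier ℓ) (Level ℓ) (Sα ℓ ψ α)
  model = (λ x → proj₁ x , refl) , (λ x i j x∈i x∈j → trans (sym x∈i) x∈j) , edges-between-levels , Witness.extension
    where
    edges-between-levels : ∀ x y → Sα ℓ ψ α x y → ∀ i j → toℕ j ≡ suc (toℕ i) → Level ℓ i x → Level ℓ j y
    edges-between-levels _ _ (_ , x≡i′ , y≡1+i′ , _) i j j≡1+i refl =
      toℕ-injective (trans y≡1+i′ (trans (cong suc (sym x≡i′)) (sym j≡1+i)))

-- only the injectivity of ψ is needed
theorem4 : (ℓ : ℕ) → 2 ≤ ℓ → (U : Machine) → UniversalPrefix U →
    (ψ : Fin (ℓ ∸ 1) → ℕ → ℕ → ℕ) → Recursive3 ψ → Bijective3 ψ →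
    (α : ℕ → Bool) → KCString U α →
    ModelT ℓ (Carrier ℓ) (Level ℓ) (Sα ℓ ψ α)
theorem4 (suc (suc ℓ′)) (s≤s (s≤s _)) U universal ψ ψ-computable (ψ-injective , _) α kc =
  Extension.model ℓ′ ψ ψ-computable ψ-injective α (KCString⇒MeetsPatterns universal kc)
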